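{- Let $k, c, r$ be integers such that $k \geq 1$, $r \geq 2k$, $r \equiv 0 \pmod 2$, $c \equiv 1 \pmod 3$ and $\frac{3(k-2)(k-1)}{2} \leq c \leq \frac{3k(k-1)}{2}$. Then there exists an $(r,c)$-circulant.
   Context: All graphs are finite and simple. For a vertex $v$, $e(v)$ denotes the number of edges of the subgraph induced by the open neighbourhood of $v$. An $(r,c)$-graph is an $r$-regular graph with $e(v) = c$ for every vertex $v$. For $n \geq 2$ and $S \subseteq \{1, \dots, \lfloor n/2 \rfloor\}$, $\mathsf{Circ}(n,S)$ is the Cayley graph of $\mathbb{Z}_n$ with connection set $S \cup -S$. An $(r,c)$-circulant is a graph $\mathsf{Circ}(n,S)$ (for some $n$, $S$) that is an $(r,c)$-graph. -}

module Defs where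

open import Data.Bool using (Bool; true; false; _∧_; _∨_)
open import Data.Nat using (ℕ; zero; suc; _+_; _≤_; _<ᵇ_; _≡ᵇ_; s≤s; z≤n)
open import Data.Nat.DivMod using (_%_; _/_)
open import Data.Fin using (Fin; toℕ)
open import Data.List using (List; []; _∷_; allFin; cartesianProduct)
open import Data.Bool.ListAction using (any)
open import Data.List.Relation.Unary.All using (All)
open import Data.Product using (_×_; _,_; Σ)
open import Relation.Binary.PropositionalEquality using (_≡_)

Adj : ℕ → Set
Adj n = Fin n → Fin n → Bool

countTrue : {A : Set} → (A → Bool) → List A → ℕ
countTrue p [] = 0
countTrue p (x ∷ xs) with p x
... | true  = suc (countTrue p xs)
... | false = countTrue p xs

degree : {n : ℕ} → Adj n → Fin n → ℕ
degree {n} G v = countTrue (G v) (allFin n)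

-- e(v): number of edges of the subgraph induced by the open neighbourhood of v
-- (each edge {u,w} counted once, via toℕ u < toℕ w)
e : {n : ℕ} → Adj n → Fin n → ℕ
e {n} G v = countTrue edgeInN (cartesianProduct (allFin n) (allFin n))
  where
  edgeInN : Fin n × Fin n → Bool
  edgeInN (u , w) = (toℕ u <ᵇ toℕ w) ∧ G v u ∧ G v w ∧ G u w

IsRCGraph : ℕ → ℕ → {n : ℕ} → Adj n → Set
IsRCGraph r c {n} G = (v : Fin n) → (degree G v ≡ r) × (e G v ≡ c)

Circ : (n : ℕ) → 2 ≤ n → List ℕ → Adj n
Circ (suc n) (s≤s _) S i j =
  any (λ s → (((toℕ i + s) % suc n) ≡ᵇ toℕ j) ∨ (((toℕ j + s) % suc n) ≡ᵇ toℕ i)) S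

ValidConnSet : ℕ → List ℕ → Set
ValidConnSet n S = All (λ s → (1 ≤ s) × (s ≤ n / 2)) S

ExistsRCCirculant : ℕ → ℕ → Set
ExistsRCCirculant r c =
  Σ ℕ λ n → Σ (2 ≤ n) λ h → Σ (List ℕ) λ S →
    ValidConnSet n S × IsRCGraph r c (Circ n h S)

{-# OPTIONS --safe #-}
-- Call S admissible for n when its elements are distinct and 0 < s < n/2.
-- Then every vertex of Circ(n, S) has degree 2|S|, and translating the
-- neighbourhood of v to that of 0 shows
--   e(v) = Σ_{s,s′ ∈ S} ([s − s′ ∈ ±S] + [s + s′ ∈ ±S (mod n)]).
-- Replacing (n, S) by (4n, {1} ∪ 4S) keeps S admissible, adds a generator and
-- leaves this sum unchanged (compare residues mod 4), so it suffices to reach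
-- degree 2k.  For M = m + t + 1, Circ(3M, {1, …, m} ∪ {M}) has degree 2(m + 1)
-- and e = 1 + 3(C(m,2) + (m − t)): the triangle {0, M, 2M} gives the 1, the
-- pairs inside {1, …, m} give m(m − 1) + C(m,2), and the pairs that involve M
-- or sum to M give 3(m − t).  The hypotheses on c give
-- c = 1 + 3(C(k − 1, 2) + j) with j ≤ k − 1; take m = k − 1, t = m − j and
-- blow up r/2 − k times.
module Submission where

open import Defs
open import Algebra.Bundles using (CommutativeMonoid)
open import Data.Bool using (Bool; true; false; _∧_; _∨_; not; T)
open import Data.Bool.ListAction using (any; or)
open import Data.Bool.Properties using (∨-comm; ∨-assoc; ∨-commutativeMonoid; T-∨)
open import Data.Empty using (⊥; ⊥-elim)
open import Data.Fin using (Fin; toℕ)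
open import Data.Fin.Properties using (toℕ<n)
open import Data.List
  using (List; []; _∷_; _++_; map; length; upTo; allFin; tabulate; applyUpTo; applyDownFrom; cartesianProduct)
open import Data.List.Membership.Propositional using (_∈_; _∉_; find; lose)
open import Data.List.Membership.Propositional.Properties
  using (∈-map⁻; ∈-upTo⁺; ∈-upTo⁻; ∈-applyDownFrom⁺; ∈-applyDownFrom⁻)
open import Data.List.Properties
  using (map-tabulate; map-cong-local; map-∘; length-map; length-++; length-applyDownFrom)
open import Data.List.Relation.Binary.Disjoint.Propositional using (Disjoint)
open import Data.List.Relation.Unary.All as All using (All; []; _∷_)
open import Data.List.Relation.Unary.All.Properties as All using (All¬⇒¬Any)
open import Data.List.Relation.Unary.AllPairs using ([]; _∷_)
open import Data.List.Relation.Unary.Any using (here; there)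
open import Data.List.Relation.Unary.Any.Properties using (any⁺; any⁻)
open import Data.List.Relation.Unary.Unique.Propositional using (Unique)
import Data.List.Relation.Unary.Unique.Propositional.Properties as Unique
open import Data.Nat
  using (ℕ; zero; suc; _+_; _*_; _∸_; _≤_; _<_; _⊓_; _≡ᵇ_; _<ᵇ_; _≤ᵇ_; NonZero; s≤s; z≤n; z<s; s≤s⁻¹)
open import Data.Nat.Combinatorics using (_C_; nC1≡n; nCk+nC[k+1]≡[n+1]C[k+1])
open import Data.Nat.DivMod
open import Data.Nat.Properties
open import Data.Nat.Tactic.RingSolver using (solve-∀)
open import Data.Product using (_×_; _,_; proj₁; proj₂; ∃-syntax; ∃₂)
open import Data.Sum as Sum using (_⊎_; inj₁; inj₂)
open import Data.Unit using (tt)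
open import Function using (_∘_; _$_; _⇔_; mk⇔; Equivalence)
open import Relation.Binary.Definitions using (tri<; tri≈; tri>)
open import Relation.Binary.PropositionalEquality
open import Relation.Nullary.Decidable
  using (Dec; does; yes; no; dec-true; dec-false; does-⇔; T?; ¬?; _⊎-dec_; _×-dec_; True; toWitness)
open import Relation.Nullary.Negation using (¬_; contradiction)
open import Algebra.Properties.CommutativeSemigroup +-commutativeSemigroup
  using () renaming (interchange to +-interchange)
open import Algebra.Properties.CommutativeSemigroup *-commutativeSemigroup
  using () renaming (x∙yz≈y∙xz to *-x∙yz≈y∙xz)
open import Algebra.Properties.CommutativeSemigroup
  (CommutativeMonoid.commutativeSemigroup ∨-commutativeMonoid)
  using () renaming (interchange to ∨-interchange)

private variable A B : Set

𝟙 : Bool → ℕ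
𝟙 true  = 1
𝟙 false = 0

𝟙-∧ : ∀ a b → 𝟙 (a ∧ b) ≡ 𝟙 a * 𝟙 b
𝟙-∧ true  b = sym (*-identityˡ (𝟙 b))
𝟙-∧ false b = refl

𝟙-∧-pull : ∀ a b c d → 𝟙 (a ∧ b ∧ c ∧ d) ≡ 𝟙 b * (𝟙 c * 𝟙 (a ∧ d))
𝟙-∧-pull a b c d = begin
  𝟙 (a ∧ b ∧ c ∧ d)            ≡⟨ 𝟙-∧ a _ ⟩
  𝟙 a * 𝟙 (b ∧ c ∧ d)          ≡⟨ cong (𝟙 a *_) (trans (𝟙-∧ b _) (cong (𝟙 b *_) (𝟙-∧ c d))) ⟩
  𝟙 a * (𝟙 b * (𝟙 c * 𝟙 d))    ≡⟨ *-x∙yz≈y∙xz (𝟙 a) (𝟙 b) _ ⟩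
  𝟙 b * (𝟙 a * (𝟙 c * 𝟙 d))    ≡⟨ cong (𝟙 b *_) (*-x∙yz≈y∙xz (𝟙 a) (𝟙 c) (𝟙 d)) ⟩
  𝟙 b * (𝟙 c * (𝟙 a * 𝟙 d))    ≡⟨ cong (λ k → 𝟙 b * (𝟙 c * k)) (𝟙-∧ a d) ⟨
  𝟙 b * (𝟙 c * 𝟙 (a ∧ d))      ∎
  where open ≡-Reasoning

𝟙-∨-disjoint : ∀ {a b} → (T a → T b → ⊥) → 𝟙 (a ∨ b) ≡ 𝟙 a + 𝟙 b
𝟙-∨-disjoint {false} {b}     _       = refl
𝟙-∨-disjoint {true}  {false} _       = refl
𝟙-∨-disjoint {true}  {true}  disjoint = ⊥-elim (disjoint tt tt)

∑ : List A → (A → ℕ) → ℕ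
∑ []       f = 0
∑ (x ∷ xs) f = f x + ∑ xs f

infixl 10 ∑
syntax ∑ xs (λ x → e) = ∑[ x ∈ xs ] e

∑-cong : (xs : List A) {f g : A → ℕ} → (∀ {x} → x ∈ xs → f x ≡ g x) → ∑ xs f ≡ ∑ xs g
∑-cong []       _  = refl
∑-cong (x ∷ xs) eq = cong₂ _+_ (eq (here refl)) (∑-cong xs (eq ∘ there))

∑-++ : (xs ys : List A) (f : A → ℕ) → ∑ (xs ++ ys) f ≡ ∑ xs f + ∑ ys f
∑-++ []       ys f = refl
∑-++ (x ∷ xs) ys f = trans (cong (f x +_) (∑-++ xs ys f)) (sym (+-assoc (f x) _ _))

∑-map : (g : A → B) (xs : List A) (f : B → ℕ) → ∑ (map g xs) f ≡ ∑ xs (f ∘ g)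
∑-map g []       f = refl
∑-map g (x ∷ xs) f = cong (f (g x) +_) (∑-map g xs f)

∑-+ : (xs : List A) (f g : A → ℕ) → ∑[ x ∈ xs ] (f x + g x) ≡ ∑ xs f + ∑ xs g
∑-+ []       f g = refl
∑-+ (x ∷ xs) f g = trans (cong (f x + g x +_) (∑-+ xs f g)) (+-interchange (f x) (g x) _ _)

∑-*ˡ : (k : ℕ) (xs : List A) (f : A → ℕ) → ∑[ x ∈ xs ] (k * f x) ≡ k * ∑ xs f
∑-*ˡ k []       f = sym (*-zeroʳ k)
∑-*ˡ k (x ∷ xs) f = trans (cong (k * f x +_) (∑-*ˡ k xs f)) (sym (*-distribˡ-+ k (f x) _))

∑-const : (xs : List A) (c : ℕ) → ∑[ _ ∈ xs ] c ≡ length xs * c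
∑-const []       c = refl
∑-const (x ∷ xs) c = cong (c +_) (∑-const xs c)

∑-zero : (xs : List A) → ∑[ _ ∈ xs ] 0 ≡ 0
∑-zero xs = trans (∑-const xs 0) (*-zeroʳ (length xs))

∑-comm : (xs : List A) (ys : List B) (f : A → B → ℕ) →
         ∑[ x ∈ xs ] ∑[ y ∈ ys ] f x y ≡ ∑[ y ∈ ys ] ∑[ x ∈ xs ] f x y
∑-comm []       ys f = sym (∑-zero ys)
∑-comm (x ∷ xs) ys f = trans (cong (∑ ys (f x) +_) (∑-comm xs ys f)) (sym (∑-+ ys (f x) _))

countTrue≡∑ : (p : A → Bool) (xs : List A) → countTrue p xs ≡ ∑[ x ∈ xs ] 𝟙 (p x)
countTrue≡∑ p []       = refl
countTrue≡∑ p (x ∷ xs) with p x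
... | true  = cong suc (countTrue≡∑ p xs)
... | false = countTrue≡∑ p xs

∑-cartesianProduct : (xs : List A) (ys : List B) (f : A × B → ℕ) →
                     ∑ (cartesianProduct xs ys) f ≡ ∑[ x ∈ xs ] ∑[ y ∈ ys ] f (x , y)
∑-cartesianProduct []       ys f = refl
∑-cartesianProduct (x ∷ xs) ys f = begin
  ∑ (map (x ,_) ys ++ cartesianProduct xs ys) f           ≡⟨ ∑-++ (map (x ,_) ys) _ f ⟩
  ∑ (map (x ,_) ys) f + ∑ (cartesianProduct xs ys) f      ≡⟨ cong₂ _+_ (∑-map (x ,_) ys f) (∑-cartesianProduct xs ys f) ⟩
  ∑[ y ∈ ys ] f (x , y) + ∑[ x′ ∈ xs ] ∑[ y ∈ ys ] f (x′ , y) ∎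
  where open ≡-Reasoning

map-toℕ-allFin : ∀ n → map toℕ (allFin n) ≡ upTo n
map-toℕ-allFin n = trans (map-tabulate (λ i → i) toℕ) (tabulate-toℕ n (λ x → x))
  where
  tabulate-toℕ : ∀ n (f : ℕ → ℕ) → tabulate {n = n} (f ∘ toℕ) ≡ applyUpTo f n
  tabulate-toℕ zero    f = refl
  tabulate-toℕ (suc n) f = cong (f 0 ∷_) (tabulate-toℕ n (f ∘ suc))

∑-allFin : ∀ n (f : ℕ → ℕ) → ∑[ i ∈ allFin n ] f (toℕ i) ≡ ∑ (upTo n) f
∑-allFin n f = trans (sym (∑-map toℕ (allFin n) f)) (cong (λ xs → ∑ xs f) (map-toℕ-allFin n))

_∈ᵇ_ : ℕ → List ℕ → Bool
x ∈ᵇ ws = any (_≡ᵇ x) ws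

∉⇒∈ᵇ-false : ∀ {x ws} → x ∉ ws → x ∈ᵇ ws ≡ false
∉⇒∈ᵇ-false {x} {[]}     _   = refl
∉⇒∈ᵇ-false {x} {w ∷ ws} x∉ rewrite dec-false (w ≟ x) (λ w≡x → x∉ (here (sym w≡x))) =
  ∉⇒∈ᵇ-false (x∉ ∘ there)

∑-point-∉ : ∀ {xs a} (h : ℕ → ℕ) → a ∉ xs → ∑[ x ∈ xs ] (𝟙 (a ≡ᵇ x) * h x) ≡ 0
∑-point-∉ {[]}     h a∉ = refl
∑-point-∉ {x ∷ xs} {a} h a∉ rewrite dec-false (a ≟ x) (a∉ ∘ here) = ∑-point-∉ h (a∉ ∘ there)

∑-point : ∀ {xs a} (h : ℕ → ℕ) → Unique xs → a ∈ xs → ∑[ x ∈ xs ] (𝟙 (a ≡ᵇ x) * h x) ≡ h a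
∑-point {x ∷ xs} h (x∉xs ∷ _) (here refl) =
  trans (cong₂ _+_ (cong (λ b → 𝟙 b * h x) (dec-true (x ≟ x) refl)) (∑-point-∉ h (All¬⇒¬Any x∉xs)))
        (trans (+-identityʳ _) (*-identityˡ (h x)))
∑-point {x ∷ xs} {a} h (x∉xs ∷ u) (there a∈xs) rewrite dec-false (a ≟ x) (λ a≡x → All.lookup x∉xs a∈xs (sym a≡x)) =
  ∑-point h u a∈xs

∑-count-∈ : ∀ {xs a} → Unique xs → a ∈ xs → ∑[ x ∈ xs ] 𝟙 (a ≡ᵇ x) ≡ 1
∑-count-∈ {xs} unique a∈xs = trans (∑-cong xs (λ _ → sym (*-identityʳ _))) (∑-point (λ _ → 1) unique a∈xs)

∑-count-∉ : ∀ {xs a} → a ∉ xs → ∑[ x ∈ xs ] 𝟙 (a ≡ᵇ x) ≡ 0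
∑-count-∉ {xs} a∉xs = trans (∑-cong xs (λ _ → sym (*-identityʳ _))) (∑-point-∉ (λ _ → 1) a∉xs)

∑-∈ᵇ : ∀ {xs ws} (h : ℕ → ℕ) → Unique xs → Unique ws → All (_∈ xs) ws →
       ∑[ x ∈ xs ] (𝟙 (x ∈ᵇ ws) * h x) ≡ ∑ ws h
∑-∈ᵇ {xs} {[]}     h _ _ _ = ∑-zero xs
∑-∈ᵇ {xs} {w ∷ ws} h u (w∉ws ∷ uws) (w∈xs ∷ ws⊆xs) = begin
  ∑[ x ∈ xs ] (𝟙 (x ∈ᵇ (w ∷ ws)) * h x)
    ≡⟨ ∑-cong xs (λ {x} _ → split x) ⟩
  ∑[ x ∈ xs ] (𝟙 (w ≡ᵇ x) * h x + 𝟙 (x ∈ᵇ ws) * h x)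
    ≡⟨ ∑-+ xs _ _ ⟩
  ∑[ x ∈ xs ] (𝟙 (w ≡ᵇ x) * h x) + ∑[ x ∈ xs ] (𝟙 (x ∈ᵇ ws) * h x)
    ≡⟨ cong₂ _+_ (∑-point h u w∈xs) (∑-∈ᵇ h u uws ws⊆xs) ⟩
  h w + ∑ ws h ∎
  where
  open ≡-Reasoning
  split : ∀ x → 𝟙 (x ∈ᵇ (w ∷ ws)) * h x ≡ 𝟙 (w ≡ᵇ x) * h x + 𝟙 (x ∈ᵇ ws) * h x
  split x with w ≟ x
  ... | yes refl rewrite dec-true (w ≟ w) refl | ∉⇒∈ᵇ-false (All¬⇒¬Any w∉ws) = sym (+-identityʳ _)
  ... | no w≢x  rewrite dec-false (w ≟ x) w≢x = refl

∑∑-<ᵇ-double : (ws : List ℕ) (R : ℕ → ℕ → Bool) → (∀ x y → R x y ≡ R y x) →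
               (∀ {x} → x ∈ ws → R x x ≡ false) →
               2 * ∑[ x ∈ ws ] ∑[ y ∈ ws ] 𝟙 ((x <ᵇ y) ∧ R x y) ≡ ∑[ x ∈ ws ] ∑[ y ∈ ws ] 𝟙 (R x y)
∑∑-<ᵇ-double ws R sym-R irrefl-R = begin
  2 * below
    ≡⟨ cong (below +_) (+-identityʳ below) ⟩
  below + below
    ≡⟨ cong (below +_) below≡above ⟩
  below + ∑[ x ∈ ws ] ∑[ y ∈ ws ] 𝟙 ((y <ᵇ x) ∧ R x y)
    ≡⟨ ∑-+ ws _ _ ⟨
  ∑[ x ∈ ws ] (∑[ y ∈ ws ] 𝟙 ((x <ᵇ y) ∧ R x y) + ∑[ y ∈ ws ] 𝟙 ((y <ᵇ x) ∧ R x y))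
    ≡⟨ ∑-cong ws (λ x∈ws → trans (sym (∑-+ ws _ _)) (∑-cong ws (λ _ → split x∈ws _))) ⟩
  ∑[ x ∈ ws ] ∑[ y ∈ ws ] 𝟙 (R x y) ∎
  where
  open ≡-Reasoning
  below = ∑[ x ∈ ws ] ∑[ y ∈ ws ] 𝟙 ((x <ᵇ y) ∧ R x y)
  below≡above : below ≡ ∑[ x ∈ ws ] ∑[ y ∈ ws ] 𝟙 ((y <ᵇ x) ∧ R x y)
  below≡above = trans (∑-comm ws ws _) (∑-cong ws λ {x} _ → ∑-cong ws λ {y} _ →
                                          cong (λ b → 𝟙 ((y <ᵇ x) ∧ b)) (sym-R y x))
  split : ∀ {x} → x ∈ ws → ∀ y → 𝟙 ((x <ᵇ y) ∧ R x y) + 𝟙 ((y <ᵇ x) ∧ R x y) ≡ 𝟙 (R x y)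
  split {x} x∈ws y with <-cmp x y
  ... | tri< x<y _ _ rewrite dec-true (x <? y) x<y | dec-false (y <? x) (<⇒≯ x<y) = +-identityʳ _
  ... | tri≈ _ refl _ rewrite dec-false (x <? x) (<-irrefl refl) | irrefl-R x∈ws = refl
  ... | tri> _ _ y<x rewrite dec-false (x <? y) (<⇒≯ y<x) | dec-true (y <? x) y<x = refl

any-cong : {p q : A → Bool} (xs : List A) → (∀ {x} → x ∈ xs → p x ≡ q x) → any p xs ≡ any q xs
any-cong xs eq = cong or (map-cong-local (All.tabulate eq))

any-false : {p : A → Bool} (xs : List A) → (∀ {x} → x ∈ xs → p x ≡ false) → any p xs ≡ false
any-false []       _   = refl
any-false (x ∷ xs) eq rewrite eq (here refl) = any-false xs (eq ∘ there)

any-map : (p : B → Bool) (f : A → B) (xs : List A) → any p (map f xs) ≡ any (p ∘ f) xs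
any-map p f xs = cong or (sym (map-∘ xs))

any-++ : (p : A → Bool) (xs ys : List A) → any p (xs ++ ys) ≡ any p xs ∨ any p ys
any-++ p []       ys = refl
any-++ p (x ∷ xs) ys = trans (cong (p x ∨_) (any-++ p xs ys)) (sym (∨-assoc (p x) _ _))

any-∨ : (p q : A → Bool) (xs : List A) → any (λ x → p x ∨ q x) xs ≡ any p xs ∨ any q xs
any-∨ p q []       = refl
any-∨ p q (x ∷ xs) = trans (cong ((p x ∨ q x) ∨_) (any-∨ p q xs)) (∨-interchange (p x) (q x) _ _)

T-any : {p : A → Bool} {xs : List A} → T (any p xs) ⇔ (∃[ x ] x ∈ xs × T (p x))
T-any {p = p} {xs} = mk⇔ (find ∘ any⁻ p xs) (λ (_ , x∈xs , px) → any⁺ p (lose x∈xs px))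

T-≡ᵇ-∨ : ∀ {a b c d} → T ((a ≡ᵇ b) ∨ (c ≡ᵇ d)) ⇔ (a ≡ b ⊎ c ≡ d)
T-≡ᵇ-∨ {a} {b} {c} {d} = mk⇔ to from
  where
  to : T ((a ≡ᵇ b) ∨ (c ≡ᵇ d)) → a ≡ b ⊎ c ≡ d
  to t = Sum.map (≡ᵇ⇒≡ a b) (≡ᵇ⇒≡ c d) (Equivalence.to T-∨ t)
  from : a ≡ b ⊎ c ≡ d → T ((a ≡ᵇ b) ∨ (c ≡ᵇ d))
  from = Equivalence.from T-∨ ∘ Sum.map (≡⇒≡ᵇ a b) (≡⇒≡ᵇ c d)

T-any-≡ᵇ-∨ : {f g h k : A → ℕ} {xs : List A} →
             T (any (λ x → (f x ≡ᵇ g x) ∨ (h x ≡ᵇ k x)) xs) ⇔ (∃[ x ] x ∈ xs × (f x ≡ g x ⊎ h x ≡ k x))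
T-any-≡ᵇ-∨ = mk⇔ (λ t → let (x , x∈xs , d) = Equivalence.to T-any t in x , x∈xs , Equivalence.to T-≡ᵇ-∨ d)
                 (λ (x , x∈xs , d) → Equivalence.from T-any (x , x∈xs , Equivalence.from T-≡ᵇ-∨ d))

≡does : ∀ {P Q : Set} {b} → T b ⇔ P → (P → Q) → (Q → P) → (q? : Dec Q) → b ≡ does q?
≡does {b = b} spec to from q? = does-⇔ (mk⇔ (to ∘ Equivalence.to spec) (Equivalence.from spec ∘ from)) (T? b) q?

-- Adjacency in Circ(n, S)

[m%d+n]%d≡[m+n]%d : ∀ m n d .{{_ : NonZero d}} → (m % d + n) % d ≡ (m + n) % d
[m%d+n]%d≡[m+n]%d m n d = begin
  (m % d + n) % d          ≡⟨ %-distribˡ-+ (m % d) n d ⟩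
  (m % d % d + n % d) % d  ≡⟨ cong (λ k → (k + n % d) % d) (m%n%n≡m%n m d) ⟩
  (m % d + n % d) % d      ≡⟨ %-distribˡ-+ m n d ⟨
  (m + n) % d              ∎
  where open ≡-Reasoning

[m+n%d]%d≡[m+n]%d : ∀ m n d .{{_ : NonZero d}} → (m + n % d) % d ≡ (m + n) % d
[m+n%d]%d≡[m+n]%d m n d = begin
  (m + n % d) % d  ≡⟨ cong (_% d) (+-comm m (n % d)) ⟩
  (n % d + m) % d  ≡⟨ [m%d+n]%d≡[m+n]%d n m d ⟩
  (n + m) % d      ≡⟨ cong (_% d) (+-comm n m) ⟩
  (m + n) % d      ∎
  where open ≡-Reasoning

-- Adding d ∸ m % d undoes the translation by m.
[m+n]%d≡[m+o]%d⇔n%d≡o%d : ∀ m n o d .{{_ : NonZero d}} → ((m + n) % d ≡ (m + o) % d) ⇔ (n % d ≡ o % d)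
[m+n]%d≡[m+o]%d⇔n%d≡o%d m n o d = mk⇔ cancel uncancel
  where
  open ≡-Reasoning
  m⁻ = d ∸ m % d
  m⁻+m≡0 : (m⁻ + m) % d ≡ 0
  m⁻+m≡0 = begin
    (m⁻ + m) % d      ≡⟨ [m+n%d]%d≡[m+n]%d m⁻ m d ⟨
    (m⁻ + m % d) % d  ≡⟨ cong (_% d) (m∸n+n≡m (m%n≤n m d)) ⟩
    d % d             ≡⟨ n%n≡0 d ⟩
    0                 ∎
  undo : ∀ k → (m⁻ + (m + k) % d) % d ≡ k % d
  undo k = begin
    (m⁻ + (m + k) % d) % d  ≡⟨ [m+n%d]%d≡[m+n]%d m⁻ (m + k) d ⟩
    (m⁻ + (m + k)) % d      ≡⟨ cong (_% d) (+-assoc m⁻ m k) ⟨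
    (m⁻ + m + k) % d        ≡⟨ [m%d+n]%d≡[m+n]%d (m⁻ + m) k d ⟨
    ((m⁻ + m) % d + k) % d  ≡⟨ cong (λ z → (z + k) % d) m⁻+m≡0 ⟩
    (0 + k) % d             ∎
  cancel : (m + n) % d ≡ (m + o) % d → n % d ≡ o % d
  cancel eq = trans (sym (undo n)) (trans (cong (λ z → (m⁻ + z) % d) eq) (undo o))
  uncancel : n % d ≡ o % d → (m + n) % d ≡ (m + o) % d
  uncancel eq = begin
    (m + n) % d      ≡⟨ [m+n%d]%d≡[m+n]%d m n d ⟨
    (m + n % d) % d  ≡⟨ cong (λ z → (m + z) % d) eq ⟩
    (m + o % d) % d  ≡⟨ [m+n%d]%d≡[m+n]%d m o d ⟩
    (m + o) % d      ∎

[m+n+[o∸m]]%o≡n : ∀ m n o .{{_ : NonZero o}} → m ≤ o → n < o → (m + n + (o ∸ m)) % o ≡ n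
[m+n+[o∸m]]%o≡n m n o m≤o n<o = begin
  (m + n + (o ∸ m)) % o  ≡⟨ cong (λ k → (k + (o ∸ m)) % o) (+-comm m n) ⟩
  (n + m + (o ∸ m)) % o  ≡⟨ cong (_% o) (trans (+-assoc n m (o ∸ m)) (cong (n +_) (m+[n∸m]≡n m≤o))) ⟩
  (n + o) % o            ≡⟨ [m+n]%n≡m%n n o ⟩
  n % o                  ≡⟨ m<n⇒m%n≡m n<o ⟩
  n                      ∎
  where open ≡-Reasoning

[m+[n∸m]]%n≡0 : ∀ m n .{{_ : NonZero n}} → m ≤ n → (m + (n ∸ m)) % n ≡ 0
[m+[n∸m]]%n≡0 m n m≤n = trans (cong (_% n) (m+[n∸m]≡n m≤n)) (n%n≡0 n)

m%n≡0⇔m≡n : ∀ {m n} .{{_ : NonZero n}} → 0 < m → m < n + n → (m % n ≡ 0) ⇔ (m ≡ n)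
m%n≡0⇔m≡n {m} {n} 0<m m<n+n = mk⇔ to (λ { refl → n%n≡0 n })
  where
  to : m % n ≡ 0 → m ≡ n
  to m%n≡0 with m <? n
  ... | yes m<n = contradiction (trans (sym (m<n⇒m%n≡m m<n)) m%n≡0) (≢-sym (<⇒≢ 0<m))
  ... | no  m≮n = ≤-antisym (m∸n≡0⇒m≤n m∸n≡0) n≤m
    where
    n≤m : n ≤ m
    n≤m = ≮⇒≥ m≮n
    m∸n≡0 : m ∸ n ≡ 0
    m∸n≡0 = begin
      m ∸ n        ≡⟨ m<n⇒m%n≡m (subst (m ∸ n <_) (m+n∸n≡m n n) (∸-monoˡ-< m<n+n n≤m)) ⟨
      (m ∸ n) % n  ≡⟨ m≤n⇒[n∸m]%m≡n%m n≤m ⟩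
      m % n        ≡⟨ m%n≡0 ⟩
      0            ∎
      where open ≡-Reasoning

2*m<n⇒m<n : ∀ {m n} → 2 * m < n → m < n
2*m<n⇒m<n {m} = ≤-<-trans (m≤m+n m (m + 0))

2*m<o⇒2*n<o⇒m+n<o : ∀ m n {o} → 2 * m < o → 2 * n < o → m + n < o
2*m<o⇒2*n<o⇒m+n<o m n {o} 2m<o 2n<o = *-cancelˡ-< 2 (m + n) o (begin-strict
  2 * (m + n)    ≡⟨ *-distribˡ-+ 2 m n ⟩
  2 * m + 2 * n  <⟨ +-mono-< 2m<o 2n<o ⟩
  o + o          ≡⟨ cong (o +_) (+-identityʳ o) ⟨
  2 * o          ∎)
  where open ≤-Reasoning

Unique-map⁺-local : {P : A → Set} {f : A → B} {xs : List A} →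
                    (∀ {x y} → P x → P y → f x ≡ f y → x ≡ y) → All P xs → Unique xs → Unique (map f xs)
Unique-map⁺-local inj []         []           = []
Unique-map⁺-local inj (px ∷ pxs) (x∉xs ∷ uxs) =
  All.map⁺ (All.zipWith (λ (py , x≢y) fx≡fy → x≢y (inj px py fx≡fy)) (pxs , x∉xs)) ∷ Unique-map⁺-local inj pxs uxs

joins : (n : ℕ) .{{_ : NonZero n}} → ℕ → ℕ → ℕ → Bool
joins n s x y = ((x + s) % n ≡ᵇ y) ∨ ((y + s) % n ≡ᵇ x)

-- Once n and h are constructor forms, Circ n h S i j unfolds to
-- adjacent n S (toℕ i) (toℕ j).
adjacent : (n : ℕ) .{{_ : NonZero n}} → List ℕ → ℕ → ℕ → Bool
adjacent n S x y = any (λ s → joins n s x y) S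

adjacent-sym : ∀ n .{{_ : NonZero n}} S x y → adjacent n S x y ≡ adjacent n S y x
adjacent-sym n S x y = any-cong S (λ {s} _ → ∨-comm ((x + s) % n ≡ᵇ y) _)

translate-≡ᵇ : ∀ n .{{_ : NonZero n}} v x s {y} → y < n →
               (((v + x) % n + s) % n ≡ᵇ (v + y) % n) ≡ ((x + s) % n ≡ᵇ y)
translate-≡ᵇ n v x s {y} y<n = does-⇔ (mk⇔ to from) (_ ≟ _) (_ ≟ _)
  where
  module Shift = Equivalence ([m+n]%d≡[m+o]%d⇔n%d≡o%d v (x + s) y n)
  shift : ((v + x) % n + s) % n ≡ (v + (x + s)) % n
  shift = trans ([m%d+n]%d≡[m+n]%d (v + x) s n) (cong (_% n) (+-assoc v x s))
  to : ((v + x) % n + s) % n ≡ (v + y) % n → (x + s) % n ≡ y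
  to eq = trans (Shift.to (trans (sym shift) eq)) (m<n⇒m%n≡m y<n)
  from : (x + s) % n ≡ y → ((v + x) % n + s) % n ≡ (v + y) % n
  from eq = trans shift (Shift.from (trans eq (sym (m<n⇒m%n≡m y<n))))

adjacent-translate : ∀ n .{{_ : NonZero n}} S v {x y} → x < n → y < n →
                     adjacent n S ((v + x) % n) ((v + y) % n) ≡ adjacent n S x y
adjacent-translate n S v {x} {y} x<n y<n =
  any-cong S (λ {s} _ → cong₂ _∨_ (translate-≡ᵇ n v x s y<n) (translate-≡ᵇ n v y s x<n))

-- Stricter than ValidConnSet (2s < n rather than s ≤ n/2), so that the 2|S|
-- elements of ±S are distinct.
record Admissible (n : ℕ) (S : List ℕ) : Set where
  field
    2≤n     : 2 ≤ n
    unique  : Unique S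
    bounded : All (λ s → 0 < s × 2 * s < n) S

connectionSet : ℕ → List ℕ → List ℕ
connectionSet n S = S ++ map (n ∸_) S

neighbours : (n : ℕ) .{{_ : NonZero n}} → List ℕ → ℕ → List ℕ
neighbours n S v = map (λ a → (v + a) % n) (connectionSet n S)

joins-irrefl : ∀ n .{{_ : NonZero n}} {s x} → 0 < s → s < n → x < n → joins n s x x ≡ false
joins-irrefl n {s} {x} 0<s s<n x<n = cong₂ _∨_ x+s≢ᵇx x+s≢ᵇx
  where
  open ≡-Reasoning
  x+s≢x : (x + s) % n ≢ x
  x+s≢x eq = <⇒≢ 0<s (sym (begin
    s      ≡⟨ m<n⇒m%n≡m s<n ⟨
    s % n  ≡⟨ Equivalence.to ([m+n]%d≡[m+o]%d⇔n%d≡o%d x s 0 n) (trans eq (sym x+0%n≡x)) ⟩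
    0 % n  ≡⟨ m<n⇒m%n≡m (≤-<-trans z≤n s<n) ⟩
    0      ∎))
    where
    x+0%n≡x : (x + 0) % n ≡ x
    x+0%n≡x = trans (cong (_% n) (+-identityʳ x)) (m<n⇒m%n≡m x<n)
  x+s≢ᵇx : ((x + s) % n ≡ᵇ x) ≡ false
  x+s≢ᵇx = dec-false (_ ≟ _) x+s≢x

adjacent-irrefl : ∀ n .{{_ : NonZero n}} {S x} → All (λ s → 0 < s × 2 * s < n) S → x < n → adjacent n S x x ≡ false
adjacent-irrefl n {S} bounded x<n = any-false S λ s∈S →
  let (0<s , 2s<n) = All.lookup bounded s∈S in joins-irrefl n 0<s (2*m<n⇒m<n 2s<n) x<n

joins≡offsets : ∀ n .{{_ : NonZero n}} {s v x} → s ≤ n → v < n → x < n →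
                joins n s v x ≡ ((v + s) % n ≡ᵇ x) ∨ ((v + (n ∸ s)) % n ≡ᵇ x)
joins≡offsets n {s} {v} {x} s≤n v<n x<n = cong (((v + s) % n ≡ᵇ x) ∨_) (does-⇔ (mk⇔ to from) (_ ≟ _) (_ ≟ _))
  where
  open ≡-Reasoning
  module Shift = Equivalence ([m+n]%d≡[m+o]%d⇔n%d≡o%d (n ∸ s) (x + s) v n)
  wrap : ((n ∸ s) + (x + s)) % n ≡ x
  wrap = begin
    ((n ∸ s) + (x + s)) % n  ≡⟨ cong (λ k → (k % n)) (trans (cong ((n ∸ s) +_) (+-comm x s)) (sym (+-assoc (n ∸ s) s x))) ⟩
    ((n ∸ s) + s + x) % n    ≡⟨ cong (λ k → (k + x) % n) (m∸n+n≡m s≤n) ⟩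
    (n + x) % n              ≡⟨ cong (_% n) (+-comm n x) ⟩
    (x + n) % n              ≡⟨ [m+n]%n≡m%n x n ⟩
    x % n                    ≡⟨ m<n⇒m%n≡m x<n ⟩
    x                        ∎
  to : (x + s) % n ≡ v → (v + (n ∸ s)) % n ≡ x
  to eq = begin
    (v + (n ∸ s)) % n        ≡⟨ cong (_% n) (+-comm v (n ∸ s)) ⟩
    ((n ∸ s) + v) % n        ≡⟨ Shift.from (trans eq (sym (m<n⇒m%n≡m v<n))) ⟨
    ((n ∸ s) + (x + s)) % n  ≡⟨ wrap ⟩
    x                        ∎
  from : (v + (n ∸ s)) % n ≡ x → (x + s) % n ≡ v
  from eq = begin
    (x + s) % n  ≡⟨ Shift.to (trans wrap (trans (sym eq) (cong (_% n) (+-comm v (n ∸ s))))) ⟩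
    v % n        ≡⟨ m<n⇒m%n≡m v<n ⟩
    v            ∎

adjacent≡∈ᵇneighbours : ∀ n .{{_ : NonZero n}} {S v x} → All (λ s → 0 < s × 2 * s < n) S →
                         v < n → x < n → adjacent n S v x ≡ x ∈ᵇ neighbours n S v
adjacent≡∈ᵇneighbours n {S} {v} {x} bounded v<n x<n = begin
  any (λ s → joins n s v x) S
    ≡⟨ any-cong S (λ s∈S → joins≡offsets n (<⇒≤ (2*m<n⇒m<n (proj₂ (All.lookup bounded s∈S)))) v<n x<n) ⟩
  any (λ s → ((v + s) % n ≡ᵇ x) ∨ ((v + (n ∸ s)) % n ≡ᵇ x)) S
    ≡⟨ any-∨ _ _ S ⟩
  any (λ s → (v + s) % n ≡ᵇ x) S ∨ any (λ s → (v + (n ∸ s)) % n ≡ᵇ x) S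
    ≡⟨ cong (any (λ s → (v + s) % n ≡ᵇ x) S ∨_) (any-map (λ a → (v + a) % n ≡ᵇ x) (n ∸_) S) ⟨
  any (λ a → (v + a) % n ≡ᵇ x) S ∨ any (λ a → (v + a) % n ≡ᵇ x) (map (n ∸_) S)
    ≡⟨ any-++ _ S _ ⟨
  any (λ a → (v + a) % n ≡ᵇ x) (connectionSet n S)
    ≡⟨ any-map (_≡ᵇ x) (λ a → (v + a) % n) (connectionSet n S) ⟨
  x ∈ᵇ neighbours n S v ∎
  where open ≡-Reasoning

module _ {n S} .{{_ : NonZero n}} (adm : Admissible n S) where
  open Admissible adm

  connectionSet-bounded : All (_< n) (connectionSet n S)
  connectionSet-bounded =
    All.++⁺ (All.map (2*m<n⇒m<n ∘ proj₂) bounded)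
            (All.map⁺ (All.map (λ (0<s , 2s<n) → ∸-monoʳ-< 0<s (<⇒≤ (2*m<n⇒m<n 2s<n))) bounded))

  connectionSet-unique : Unique (connectionSet n S)
  connectionSet-unique = Unique.++⁺ unique (Unique-map⁺-local ∸-cancelˡ-≡ S≤n unique) disjoint
    where
    S≤n : All (_≤ n) S
    S≤n = All.map (<⇒≤ ∘ 2*m<n⇒m<n ∘ proj₂) bounded
    disjoint : Disjoint S (map (n ∸_) S)
    disjoint (a∈S , a∈-S) with ∈-map⁻ (n ∸_) a∈-S
    ... | s , s∈S , refl = <-irrefl (m∸n+n≡m (All.lookup S≤n s∈S)) (2*m<o⇒2*n<o⇒m+n<o (n ∸ s) s 2a<n 2s<n)
      where
      2a<n = proj₂ (All.lookup bounded a∈S)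
      2s<n = proj₂ (All.lookup bounded s∈S)

  neighbours-unique : ∀ {v} → Unique (neighbours n S v)
  neighbours-unique {v} = Unique-map⁺-local injective connectionSet-bounded connectionSet-unique
    where
    injective : ∀ {a b} → a < n → b < n → (v + a) % n ≡ (v + b) % n → a ≡ b
    injective {a} {b} a<n b<n eq = begin
      a      ≡⟨ m<n⇒m%n≡m a<n ⟨
      a % n  ≡⟨ Equivalence.to ([m+n]%d≡[m+o]%d⇔n%d≡o%d v a b n) eq ⟩
      b % n  ≡⟨ m<n⇒m%n≡m b<n ⟩
      b      ∎
      where open ≡-Reasoning

  neighbours-bounded : ∀ {v} → All (_< n) (neighbours n S v)
  neighbours-bounded {v} = All.map⁺ (All.universal (λ a → m%n<n (v + a) n) _)

  ∑-adjacent : ∀ {v} → v < n → (h : ℕ → ℕ) →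
               ∑[ x ∈ upTo n ] (𝟙 (adjacent n S v x) * h x) ≡ ∑ (neighbours n S v) h
  ∑-adjacent {v} v<n h = begin
    ∑[ x ∈ upTo n ] (𝟙 (adjacent n S v x) * h x)
      ≡⟨ ∑-cong (upTo n) (λ x∈ → cong (λ b → 𝟙 b * h _) (adjacent≡∈ᵇneighbours n bounded v<n (∈-upTo⁻ x∈))) ⟩
    ∑[ x ∈ upTo n ] (𝟙 (x ∈ᵇ neighbours n S v) * h x)
      ≡⟨ ∑-∈ᵇ h (Unique.upTo⁺ n) neighbours-unique (All.map ∈-upTo⁺ neighbours-bounded) ⟩
    ∑ (neighbours n S v) h ∎
    where open ≡-Reasoning

degree-Circ : ∀ {n S} (2≤n : 2 ≤ n) → Admissible n S → (v : Fin n) → degree (Circ n 2≤n S) v ≡ 2 * length S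
degree-Circ {suc n} {S} (s≤s _) adm v = begin
  countTrue (λ j → adjacent (suc n) S (toℕ v) (toℕ j)) (allFin (suc n))
    ≡⟨ countTrue≡∑ _ (allFin (suc n)) ⟩
  ∑[ j ∈ allFin (suc n) ] 𝟙 (adjacent (suc n) S (toℕ v) (toℕ j))
    ≡⟨ ∑-allFin (suc n) _ ⟩
  ∑[ x ∈ upTo (suc n) ] 𝟙 (adjacent (suc n) S (toℕ v) x)
    ≡⟨ ∑-cong (upTo (suc n)) (λ _ → sym (*-identityʳ _)) ⟩
  ∑[ x ∈ upTo (suc n) ] (𝟙 (adjacent (suc n) S (toℕ v) x) * 1)
    ≡⟨ ∑-adjacent adm (toℕ<n v) (λ _ → 1) ⟩
  ∑[ _ ∈ neighbours (suc n) S (toℕ v) ] 1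
    ≡⟨ trans (∑-const (neighbours (suc n) S (toℕ v)) 1) (*-identityʳ _) ⟩
  length (neighbours (suc n) S (toℕ v))
    ≡⟨ trans (length-map _ (connectionSet (suc n) S)) (length-++ S) ⟩
  length S + length (map (suc n ∸_) S)
    ≡⟨ cong (length S +_) (trans (length-map _ S) (sym (+-identityʳ _))) ⟩
  2 * length S ∎
  where open ≡-Reasoning

-- Edges inside a neighbourhood

-- For arguments below n/2, differsBy S x y says x − y ∈ ±S and inConnSet n S z
-- says z ≡ ±s (mod n) for some s ∈ S.
differsBy : List ℕ → ℕ → ℕ → Bool
differsBy S x y = any (λ s → (x + s ≡ᵇ y) ∨ (y + s ≡ᵇ x)) S

inConnSet : ℕ → List ℕ → ℕ → Bool
inConnSet n S z = any (λ s → (s ≡ᵇ z) ∨ (z + s ≡ᵇ n)) S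

differsBy-sym : ∀ S x y → differsBy S x y ≡ differsBy S y x
differsBy-sym S x y = any-cong S (λ {s} _ → ∨-comm (x + s ≡ᵇ y) _)

differsBy-irrefl : ∀ {S} x → All (0 <_) S → differsBy S x x ≡ false
differsBy-irrefl {S} x positive = any-false S λ s∈S → self-step (All.lookup positive s∈S)
  where
  self-step : ∀ {s} → 0 < s → (x + s ≡ᵇ x) ∨ (x + s ≡ᵇ x) ≡ false
  self-step {suc s} _ = cong₂ _∨_ x+1+s≢ᵇx x+1+s≢ᵇx
    where x+1+s≢ᵇx = dec-false (x + suc s ≟ x) (m+1+n≢m x)

differsBy-spec : ∀ {S x y} → T (differsBy S x y) ⇔ (∃[ s ] s ∈ S × (x + s ≡ y ⊎ y + s ≡ x))
differsBy-spec = T-any-≡ᵇ-∨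

inConnSet-spec : ∀ {n S z} → T (inConnSet n S z) ⇔ (∃[ s ] s ∈ S × (s ≡ z ⊎ z + s ≡ n))
inConnSet-spec = T-any-≡ᵇ-∨

adjacent≡differsBy : ∀ n .{{_ : NonZero n}} {S x y} → All (λ s → 0 < s × 2 * s < n) S → 2 * x < n → 2 * y < n →
                     adjacent n S x y ≡ differsBy S x y
adjacent≡differsBy n {S} {x} {y} bounded 2x<n 2y<n = any-cong S λ s∈S →
  let 2s<n = proj₂ (All.lookup bounded s∈S) in
  cong₂ _∨_ (cong (_≡ᵇ y) (m<n⇒m%n≡m (2*m<o⇒2*n<o⇒m+n<o x _ 2x<n 2s<n)))
            (cong (_≡ᵇ x) (m<n⇒m%n≡m (2*m<o⇒2*n<o⇒m+n<o y _ 2y<n 2s<n)))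

adjacent-0≡inConnSet : ∀ n .{{_ : NonZero n}} {S z} → All (λ s → 0 < s × 2 * s < n) S → 0 < z → z < n →
                       adjacent n S 0 z ≡ inConnSet n S z
adjacent-0≡inConnSet n {S} {z} bounded 0<z z<n = any-cong S λ s∈S →
  let (0<s , 2s<n) = All.lookup bounded s∈S ; s<n = 2*m<n⇒m<n 2s<n in
  cong₂ _∨_ (cong (_≡ᵇ z) (m<n⇒m%n≡m s<n))
            (does-⇔ (m%n≡0⇔m≡n (<-≤-trans 0<z (m≤m+n z _)) (+-mono-< z<n s<n)) (_ ≟ _) (_ ≟ _))

module _ (n : ℕ) .{{_ : NonZero n}} (S : List ℕ) {x y : ℕ} (x+y<n : x + y < n) where
  private
    x<n : x < n
    x<n = ≤-<-trans (m≤m+n x y) x+y<n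
    y<n : y < n
    y<n = ≤-<-trans (m≤n+m y x) x+y<n
    n∸-< : ∀ {z} → 0 < z → z < n → n ∸ z < n
    n∸-< 0<z z<n = ∸-monoʳ-< 0<z (<⇒≤ z<n)

  adjacent-negate : 0 < x → 0 < y → adjacent n S (n ∸ x) (n ∸ y) ≡ adjacent n S y x
  adjacent-negate 0<x 0<y = begin
    adjacent n S (n ∸ x) (n ∸ y)
      ≡⟨ adjacent-translate n S (x + y) (n∸-< 0<x x<n) (n∸-< 0<y y<n) ⟨
    adjacent n S ((x + y + (n ∸ x)) % n) ((x + y + (n ∸ y)) % n)
      ≡⟨ cong₂ (adjacent n S) ([m+n+[o∸m]]%o≡n x y n (<⇒≤ x<n) y<n)
                              (trans (cong (λ k → (k + (n ∸ y)) % n) (+-comm x y)) ([m+n+[o∸m]]%o≡n y x n (<⇒≤ y<n) x<n)) ⟩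
    adjacent n S y x ∎
    where open ≡-Reasoning

  adjacent-negateʳ : 0 < y → adjacent n S x (n ∸ y) ≡ adjacent n S 0 (x + y)
  adjacent-negateʳ 0<y = begin
    adjacent n S x (n ∸ y)
      ≡⟨ adjacent-translate n S y x<n (n∸-< 0<y y<n) ⟨
    adjacent n S ((y + x) % n) ((y + (n ∸ y)) % n)
      ≡⟨ cong₂ (adjacent n S) (trans (cong (_% n) (+-comm y x)) (m<n⇒m%n≡m x+y<n)) ([m+[n∸m]]%n≡0 y n (<⇒≤ y<n)) ⟩
    adjacent n S (x + y) 0
      ≡⟨ adjacent-sym n S (x + y) 0 ⟩
    adjacent n S 0 (x + y) ∎
    where open ≡-Reasoning

  adjacent-negateˡ : 0 < x → adjacent n S (n ∸ x) y ≡ adjacent n S 0 (x + y)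
  adjacent-negateˡ 0<x = begin
    adjacent n S (n ∸ x) y
      ≡⟨ adjacent-translate n S x (n∸-< 0<x x<n) y<n ⟨
    adjacent n S ((x + (n ∸ x)) % n) ((x + y) % n)
      ≡⟨ cong₂ (adjacent n S) ([m+[n∸m]]%n≡0 x n (<⇒≤ x<n)) (m<n⇒m%n≡m x+y<n) ⟩
    adjacent n S 0 (x + y) ∎
    where open ≡-Reasoning

∑-connectionSet : ∀ n S (f : ℕ → ℕ) → ∑ (connectionSet n S) f ≡ ∑[ s ∈ S ] (f s + f (n ∸ s))
∑-connectionSet n S f = trans (∑-++ S _ f) (trans (cong (∑ S f +_) (∑-map (n ∸_) S f)) (sym (∑-+ S _ _)))

pairWeight : ℕ → List ℕ → ℕ → ℕ → ℕ
pairWeight n S x y = 𝟙 (differsBy S x y) + 𝟙 (inConnSet n S (x + y))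

pairWeight-sym : ∀ n S x y → pairWeight n S x y ≡ pairWeight n S y x
pairWeight-sym n S x y = cong₂ _+_ (cong 𝟙 (differsBy-sym S x y)) (cong (𝟙 ∘ inConnSet n S) (+-comm x y))

neighbourhoodEdges : ℕ → List ℕ → ℕ
neighbourhoodEdges n S = ∑[ x ∈ S ] ∑[ y ∈ S ] pairWeight n S x y

-- Translating by s + s′, s′ and s carries the blocks (−s, −s′), (s, −s′) and
-- (−s, s′) of ±S × ±S to (s′, s), (s + s′, 0) and (0, s + s′).
∑∑-adjacent-connectionSet : ∀ {n S} .{{_ : NonZero n}} → Admissible n S →
  ∑[ a ∈ connectionSet n S ] ∑[ b ∈ connectionSet n S ] 𝟙 (adjacent n S a b) ≡ 2 * neighbourhoodEdges n S
∑∑-adjacent-connectionSet {n} {S} adm = begin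
  ∑[ a ∈ ±S ] ∑[ b ∈ ±S ] 𝟙 (adjacent n S a b)
    ≡⟨ ∑-connectionSet n S _ ⟩
  ∑[ s ∈ S ] (∑[ b ∈ ±S ] 𝟙 (adjacent n S s b) + ∑[ b ∈ ±S ] 𝟙 (adjacent n S (n ∸ s) b))
    ≡⟨ ∑-cong S (λ s∈S → cong₂ _+_ (row s∈S) (row⁻ s∈S)) ⟩
  ∑[ s ∈ S ] (P s + P s)
    ≡⟨ ∑-+ S P P ⟩
  ∑ S P + ∑ S P
    ≡⟨ cong (∑ S P +_) (+-identityʳ (∑ S P)) ⟨
  2 * neighbourhoodEdges n S ∎
  where
  open ≡-Reasoning
  open Admissible adm
  ±S = connectionSet n S
  P : ℕ → ℕ
  P s = ∑[ s′ ∈ S ] pairWeight n S s s′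
  module _ {s s′} (s∈S : s ∈ S) (s′∈S : s′ ∈ S) where
    0<s = proj₁ (All.lookup bounded s∈S)
    0<s′ = proj₁ (All.lookup bounded s′∈S)
    2s<n = proj₂ (All.lookup bounded s∈S)
    2s′<n = proj₂ (All.lookup bounded s′∈S)
    s+s′<n : s + s′ < n
    s+s′<n = 2*m<o⇒2*n<o⇒m+n<o s s′ 2s<n 2s′<n
    sum-block : adjacent n S 0 (s + s′) ≡ inConnSet n S (s + s′)
    sum-block = adjacent-0≡inConnSet n bounded (<-≤-trans 0<s (m≤m+n s s′)) s+s′<n
    same : adjacent n S s s′ ≡ differsBy S s s′
    same = adjacent≡differsBy n bounded 2s<n 2s′<n
    negated : adjacent n S (n ∸ s) (n ∸ s′) ≡ differsBy S s s′
    negated = trans (adjacent-negate n S s+s′<n 0<s 0<s′) (trans (adjacent-sym n S s′ s) same)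
    mixedʳ : adjacent n S s (n ∸ s′) ≡ inConnSet n S (s + s′)
    mixedʳ = trans (adjacent-negateʳ n S s+s′<n 0<s′) sum-block
    mixedˡ : adjacent n S (n ∸ s) s′ ≡ inConnSet n S (s + s′)
    mixedˡ = trans (adjacent-negateˡ n S s+s′<n 0<s) sum-block
  row : ∀ {s} → s ∈ S → ∑[ b ∈ ±S ] 𝟙 (adjacent n S s b) ≡ P s
  row s∈S = trans (∑-connectionSet n S _) (∑-cong S λ s′∈S →
    cong₂ _+_ (cong 𝟙 (same s∈S s′∈S)) (cong 𝟙 (mixedʳ s∈S s′∈S)))
  row⁻ : ∀ {s} → s ∈ S → ∑[ b ∈ ±S ] 𝟙 (adjacent n S (n ∸ s) b) ≡ P s
  row⁻ {s} s∈S = trans (∑-connectionSet n S _) (∑-cong S λ {s′} s′∈S →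
    trans (cong₂ _+_ (cong 𝟙 (mixedˡ s∈S s′∈S)) (cong 𝟙 (negated s∈S s′∈S)))
          (+-comm (𝟙 (inConnSet n S (s + s′))) _))

e-Circ : ∀ {n S} (2≤n : 2 ≤ n) → Admissible n S → (v : Fin n) → e (Circ n 2≤n S) v ≡ neighbourhoodEdges n S
e-Circ {suc n} {S} 2≤n@(s≤s _) adm v = *-cancelˡ-≡ _ _ 2 (begin
  2 * e (Circ N 2≤n S) v                           ≡⟨ cong (2 *_) e≡∑∑-neighbours ⟩
  2 * ∑[ x ∈ W ] ∑[ y ∈ W ] ordered x y             ≡⟨ ∑∑-<ᵇ-double W adj (adjacent-sym N S) adj-irrefl ⟩
  ∑[ x ∈ W ] ∑[ y ∈ W ] 𝟙 (adj x y)                ≡⟨ ∑∑-neighbours≡∑∑-connectionSet ⟩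
  ∑[ a ∈ ±S ] ∑[ b ∈ ±S ] 𝟙 (adj a b)              ≡⟨ ∑∑-adjacent-connectionSet adm ⟩
  2 * neighbourhoodEdges N S                       ∎)
  where
  open ≡-Reasoning
  N = suc n
  v′ = toℕ v
  adj = adjacent N S
  W = neighbours N S v′
  ±S = connectionSet N S

  adj-irrefl : ∀ {x} → x ∈ W → adj x x ≡ false
  adj-irrefl x∈W = adjacent-irrefl N (Admissible.bounded adm) (All.lookup (neighbours-bounded adm {v′}) x∈W)

  edge : ℕ → ℕ → Bool
  edge x y = (x <ᵇ y) ∧ adj v′ x ∧ adj v′ y ∧ adj x y

  edgeInN : Fin N × Fin N → Bool
  edgeInN (i , j) = edge (toℕ i) (toℕ j)

  ordered : ℕ → ℕ → ℕ
  ordered x y = 𝟙 ((x <ᵇ y) ∧ adj x y)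

  e≡∑∑-neighbours : e (Circ N 2≤n S) v ≡ ∑[ x ∈ W ] ∑[ y ∈ W ] ordered x y
  e≡∑∑-neighbours = begin
    e (Circ N 2≤n S) v
      ≡⟨ countTrue≡∑ edgeInN (cartesianProduct (allFin N) (allFin N)) ⟩
    ∑[ p ∈ cartesianProduct (allFin N) (allFin N) ] 𝟙 (edgeInN p)
      ≡⟨ ∑-cartesianProduct (allFin N) (allFin N) (𝟙 ∘ edgeInN) ⟩
    ∑[ i ∈ allFin N ] ∑[ j ∈ allFin N ] 𝟙 (edge (toℕ i) (toℕ j))
      ≡⟨ trans (∑-cong (allFin N) (λ {i} _ → ∑-allFin N (𝟙 ∘ edge (toℕ i))))
               (∑-allFin N (λ x → ∑[ y ∈ upTo N ] 𝟙 (edge x y))) ⟩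
    ∑[ x ∈ upTo N ] ∑[ y ∈ upTo N ] 𝟙 (edge x y)
      ≡⟨ ∑-cong (upTo N) (λ {x} _ → trans (∑-cong (upTo N) (λ {y} _ → 𝟙-∧-pull (x <ᵇ y) (adj v′ x) (adj v′ y) (adj x y)))
                                           (∑-*ˡ (𝟙 (adj v′ x)) (upTo N) (λ y → 𝟙 (adj v′ y) * ordered x y))) ⟩
    ∑[ x ∈ upTo N ] (𝟙 (adj v′ x) * ∑[ y ∈ upTo N ] (𝟙 (adj v′ y) * ordered x y))
      ≡⟨ ∑-adjacent adm (toℕ<n v) (λ x → ∑[ y ∈ upTo N ] (𝟙 (adj v′ y) * ordered x y)) ⟩
    ∑[ x ∈ W ] ∑[ y ∈ upTo N ] (𝟙 (adj v′ y) * ordered x y)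
      ≡⟨ ∑-cong W (λ {x} _ → ∑-adjacent adm (toℕ<n v) (ordered x)) ⟩
    ∑[ x ∈ W ] ∑[ y ∈ W ] ordered x y ∎

  ∑∑-neighbours≡∑∑-connectionSet : ∑[ x ∈ W ] ∑[ y ∈ W ] 𝟙 (adj x y) ≡ ∑[ a ∈ ±S ] ∑[ b ∈ ±S ] 𝟙 (adj a b)
  ∑∑-neighbours≡∑∑-connectionSet = begin
    ∑[ x ∈ W ] ∑[ y ∈ W ] 𝟙 (adj x y)
      ≡⟨ trans (∑-map _ ±S (λ x → ∑[ y ∈ W ] 𝟙 (adj x y)))
               (∑-cong ±S (λ {a} _ → ∑-map _ ±S (𝟙 ∘ adj ((v′ + a) % N)))) ⟩
    ∑[ a ∈ ±S ] ∑[ b ∈ ±S ] 𝟙 (adj ((v′ + a) % N) ((v′ + b) % N))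
      ≡⟨ ∑-cong ±S (λ a∈±S → ∑-cong ±S (λ b∈±S → cong 𝟙 (adjacent-translate N S v′ (bounded a∈±S) (bounded b∈±S)))) ⟩
    ∑[ a ∈ ±S ] ∑[ b ∈ ±S ] 𝟙 (adj a b) ∎
    where
    bounded : ∀ {a} → a ∈ ±S → a < N
    bounded = All.lookup (connectionSet-bounded adm)

admissible⇒circulant : ∀ {n S} → Admissible n S → ExistsRCCirculant (2 * length S) (neighbourhoodEdges n S)
admissible⇒circulant {n} {S} adm = n , 2≤n , S , All.map (λ (0<s , 2s<n) → 0<s , half 2s<n) bounded ,
                                   λ v → degree-Circ 2≤n adm v , e-Circ 2≤n adm v
  where
  open Admissible adm
  half : ∀ {s} → 2 * s < n → s ≤ n / 2
  half {s} 2s<n = subst (_≤ n / 2) (trans (cong (_/ 2) (*-comm 2 s)) (m*n/n≡m s 2)) (/-monoˡ-≤ 2 (<⇒≤ 2s<n))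

-- Blowing up

-- Up to unfolding, the generators 1 and 4 * s of blowUp S and the modulus 4 * n
-- are of the form r +4* a with r ≤ 1, so each test in differsBy and inConnSet
-- compares one such term, or a sum of two, with a third, all with literal
-- residues.  +4*-≡ᵇ and +4*-+-≡ᵇ split such a test into a residue test, which
-- computes, and a test on the quotients; their residue bounds are implicit
-- True (_ <? 4) proofs that Agda fills in for literals.
infixl 6 _+4*_

_+4*_ : ℕ → ℕ → ℕ
r +4* a = r + 4 * a

+4*-≡ᵇ : ∀ r a r′ b {r<4 : True (r <? 4)} {r′<4 : True (r′ <? 4)} →
         (r +4* a ≡ᵇ r′ +4* b) ≡ (r ≡ᵇ r′) ∧ (a ≡ᵇ b)
+4*-≡ᵇ r a r′ b {r<4} {r′<4} = does-⇔ (mk⇔ to from) (_ ≟ _) ((r ≟ r′) ×-dec (a ≟ b))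
  where
  residue : ∀ {k} c → True (k <? 4) → (k +4* c) % 4 ≡ k
  residue {k} c k<4 = begin
    (k + 4 * c) % 4  ≡⟨ cong (λ t → (k + t) % 4) (*-comm 4 c) ⟩
    (k + c * 4) % 4  ≡⟨ [m+kn]%n≡m%n k c 4 ⟩
    k % 4            ≡⟨ m<n⇒m%n≡m (toWitness k<4) ⟩
    k                ∎
    where open ≡-Reasoning
  to : r +4* a ≡ r′ +4* b → r ≡ r′ × a ≡ b
  to eq = r≡r′ , *-cancelˡ-≡ a b 4 (+-cancelˡ-≡ r _ _ (trans eq (cong (_+ 4 * b) (sym r≡r′))))
    where
    r≡r′ : r ≡ r′
    r≡r′ = trans (sym (residue a r<4)) (trans (cong (_% 4) eq) (residue b r′<4))
  from : r ≡ r′ × a ≡ b → r +4* a ≡ r′ +4* b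
  from (refl , refl) = refl

+4*-+-≡ᵇ : ∀ r a r′ b r″ c {r+r′<4 : True (r + r′ <? 4)} {r″<4 : True (r″ <? 4)} →
           ((r +4* a) + (r′ +4* b) ≡ᵇ r″ +4* c) ≡ (r + r′ ≡ᵇ r″) ∧ (a + b ≡ᵇ c)
+4*-+-≡ᵇ r a r′ b r″ c {r+r′<4} {r″<4} =
  trans (cong (_≡ᵇ r″ +4* c) (regroup r a r′ b)) (+4*-≡ᵇ (r + r′) (a + b) r″ c {r+r′<4} {r″<4})
  where
  regroup : ∀ r a r′ b → (r + 4 * a) + (r′ + 4 * b) ≡ (r + r′) + 4 * (a + b)
  regroup = solve-∀

blowUp : List ℕ → List ℕ
blowUp S = 1 ∷ map (4 *_) S

differsBy-blowUp : ∀ S x y → differsBy (blowUp S) (4 * x) (4 * y) ≡ differsBy S x y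
differsBy-blowUp S x y = cong₂ _∨_
  (cong₂ _∨_ (+4*-+-≡ᵇ 0 x 1 0 0 y) (+4*-+-≡ᵇ 0 y 1 0 0 x))
  (trans (any-map _ (4 *_) S) (any-cong S λ {σ} _ → cong₂ _∨_ (+4*-+-≡ᵇ 0 x 0 σ 0 y) (+4*-+-≡ᵇ 0 y 0 σ 0 x)))

inConnSet-blowUp : ∀ n S w → inConnSet (4 * n) (blowUp S) (4 * w) ≡ inConnSet n S w
inConnSet-blowUp n S w = cong₂ _∨_
  (cong₂ _∨_ (+4*-≡ᵇ 1 0 0 w) (+4*-+-≡ᵇ 0 w 1 0 0 n))
  (trans (any-map _ (4 *_) S) (any-cong S λ {σ} _ → cong₂ _∨_ (+4*-≡ᵇ 0 σ 0 w) (+4*-+-≡ᵇ 0 w 0 σ 0 n)))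

pairWeight-blowUp : ∀ n S s s′ → pairWeight (4 * n) (blowUp S) (4 * s) (4 * s′) ≡ pairWeight n S s s′
pairWeight-blowUp n S s s′ = cong₂ _+_
  (cong 𝟙 (differsBy-blowUp S s s′))
  (cong 𝟙 (trans (cong (inConnSet (4 * n) (blowUp S)) (sym (*-distribˡ-+ 4 s s′)))
                 (inConnSet-blowUp n S (s + s′))))

pairWeight-blowUp-1-scaled : ∀ n S {s} → 0 < s → pairWeight (4 * n) (blowUp S) 1 (4 * s) ≡ 0
pairWeight-blowUp-1-scaled n S {suc s} _ = cong₂ _+_ (cong 𝟙 differs) (cong 𝟙 inConn)
  where
  differs : differsBy (blowUp S) 1 (4 * suc s) ≡ false
  differs = cong₂ _∨_
    (cong₂ _∨_ (+4*-≡ᵇ 2 0 0 (suc s)) (+4*-+-≡ᵇ 0 (suc s) 1 0 1 0))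
    (trans (any-map _ (4 *_) S) (any-false S λ {σ} _ →
      cong₂ _∨_ (+4*-≡ᵇ 1 σ 0 (suc s)) (+4*-+-≡ᵇ 0 (suc s) 0 σ 1 0)))
  inConn : inConnSet (4 * n) (blowUp S) (1 + 4 * suc s) ≡ false
  inConn = cong₂ _∨_
    (cong₂ _∨_ (+4*-≡ᵇ 1 0 1 (suc s)) (+4*-+-≡ᵇ 1 (suc s) 1 0 0 n))
    (trans (any-map _ (4 *_) S) (any-false S λ {σ} _ →
      cong₂ _∨_ (+4*-≡ᵇ 0 σ 1 (suc s)) (+4*-+-≡ᵇ 1 (suc s) 0 σ 0 n)))

pairWeight-blowUp-1-1 : ∀ n {S} → All (0 <_) S → pairWeight (4 * n) (blowUp S) 1 1 ≡ 0
pairWeight-blowUp-1-1 n {S} positive = cong₂ _+_ (cong 𝟙 differs) (cong 𝟙 inConn)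
  where
  differs : differsBy (blowUp S) 1 1 ≡ false
  differs = trans (any-map _ (4 *_) S) (any-false S λ σ∈S → shifted (All.lookup positive σ∈S))
    where
    shifted : ∀ {σ} → 0 < σ → (1 + 4 * σ ≡ᵇ 1) ∨ (1 + 4 * σ ≡ᵇ 1) ≡ false
    shifted {suc σ} _ = cong₂ _∨_ (+4*-≡ᵇ 1 (suc σ) 1 0) (+4*-≡ᵇ 1 (suc σ) 1 0)
  inConn : inConnSet (4 * n) (blowUp S) 2 ≡ false
  inConn = cong₂ _∨_
    (cong (false ∨_) (+4*-≡ᵇ 3 0 0 n))
    (trans (any-map _ (4 *_) S) (any-false S λ {σ} _ → cong₂ _∨_ (+4*-≡ᵇ 0 σ 2 0) (+4*-≡ᵇ 2 σ 0 n)))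

neighbourhoodEdges-blowUp : ∀ n {S} → All (0 <_) S → neighbourhoodEdges (4 * n) (blowUp S) ≡ neighbourhoodEdges n S
neighbourhoodEdges-blowUp n {S} positive = begin
  neighbourhoodEdges (4 * n) (blowUp S)
    ≡⟨ cong₂ _+_ (cong₂ _+_ (pairWeight-blowUp-1-1 n positive) first-row)
                 (∑-cong S₄ (λ {x} x∈S₄ → cong (_+ ∑[ y ∈ S₄ ] w x y) (first-column x∈S₄))) ⟩
  ∑[ x ∈ S₄ ] ∑[ y ∈ S₄ ] w x y
    ≡⟨ trans (∑-map (4 *_) S _) (∑-cong S (λ {s} _ → ∑-map (4 *_) S (w (4 * s)))) ⟩
  ∑[ s ∈ S ] ∑[ s′ ∈ S ] w (4 * s) (4 * s′)
    ≡⟨ ∑-cong S (λ {s} _ → ∑-cong S (λ {s′} _ → pairWeight-blowUp n S s s′)) ⟩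
  neighbourhoodEdges n S ∎
  where
  open ≡-Reasoning
  S₄ = map (4 *_) S
  w = pairWeight (4 * n) (blowUp S)
  first-row : ∑[ y ∈ S₄ ] w 1 y ≡ 0
  first-row = trans (∑-map (4 *_) S (w 1))
                    (trans (∑-cong S (pairWeight-blowUp-1-scaled n S ∘ All.lookup positive)) (∑-zero S))
  first-column : ∀ {x} → x ∈ S₄ → w x 1 ≡ 0
  first-column x∈S₄ with ∈-map⁻ (4 *_) x∈S₄
  ... | s , s∈S , refl = trans (pairWeight-sym (4 * n) (blowUp S) (4 * s) 1)
                               (pairWeight-blowUp-1-scaled n S (All.lookup positive s∈S))

blowUp-admissible : ∀ {n S} → Admissible n S → Admissible (4 * n) (blowUp S)
blowUp-admissible {n} {S} adm = record
  { 2≤n     = ≤-trans 2≤n (m≤n*m n 4)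
  ; unique  = All.map⁺ (All.map (λ (0<s , _) → <⇒≢ (<-≤-trans 1<4 (*-monoʳ-≤ 4 0<s))) bounded)
              ∷ Unique.map⁺ (*-cancelˡ-≡ _ _ 4) unique
  ; bounded = (z<s , <-≤-trans 2<8 (*-monoʳ-≤ 4 2≤n))
              ∷ All.map⁺ (All.map (λ {s} (0<s , 2s<n) → <-≤-trans z<s (*-monoʳ-≤ 4 0<s) , 2*4*s<4*n s 2s<n)
                                  bounded)
  }
  where
  open Admissible adm
  1<4 : 1 < 4
  1<4 = s≤s (s≤s z≤n)
  2<8 : 2 < 8
  2<8 = s≤s (s≤s (s≤s z≤n))
  2*4*s<4*n : ∀ s → 2 * s < n → 2 * (4 * s) < 4 * n
  2*4*s<4*n s 2s<n = subst (_< 4 * n) (*-x∙yz≈y∙xz 4 2 s) (*-monoʳ-< 4 2s<n)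

iterate-blowUp : ∀ p {n S} → Admissible n S →
                 ∃₂ λ n′ S′ → Admissible n′ S′ × length S′ ≡ p + length S
                            × neighbourhoodEdges n′ S′ ≡ neighbourhoodEdges n S
iterate-blowUp zero    adm = _ , _ , adm , refl , refl
iterate-blowUp (suc p) adm with iterate-blowUp p adm
... | n′ , S′ , adm′ , length-S′ , edges-S′ =
  4 * n′ , blowUp S′ , blowUp-admissible adm′ , cong suc (trans (length-map (4 *_) S′) length-S′) ,
  trans (neighbourhoodEdges-blowUp n′ (All.map proj₁ (Admissible.bounded adm′))) edges-S′

-- The base circulants

oneTo : ℕ → List ℕ
oneTo = applyDownFrom suc

∈-oneTo⁺ : ∀ {m a} → 0 < a → a ≤ m → a ∈ oneTo m
∈-oneTo⁺ {a = suc a} _ a<m = ∈-applyDownFrom⁺ suc a<m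

∈-oneTo⁻ : ∀ {m a} → a ∈ oneTo m → 0 < a × a ≤ m
∈-oneTo⁻ a∈oneTo with ∈-applyDownFrom⁻ suc a∈oneTo
... | _ , i<m , refl = z<s , i<m

oneTo-unique : ∀ m → Unique (oneTo m)
oneTo-unique m = Unique.applyDownFrom⁺₁ suc m (λ j<i _ eq → <⇒≢ j<i (sym (suc-injective eq)))

∑-oneTo-const : ∀ m c → ∑[ _ ∈ oneTo m ] c ≡ m * c
∑-oneTo-const m c = trans (∑-const (oneTo m) c) (cong (_* c) (length-applyDownFrom suc m))

∑-oneTo-< : ∀ m c → ∑[ y ∈ oneTo m ] 𝟙 (c <ᵇ y) ≡ m ∸ c
∑-oneTo-< zero    c = sym (0∸n≡0 c)
∑-oneTo-< (suc m) c with c ≤? m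
... | yes c≤m = trans (cong₂ _+_ (cong 𝟙 (dec-true (c <? suc m) (s≤s c≤m))) (∑-oneTo-< m c))
                      (sym (+-∸-assoc 1 c≤m))
... | no  c≰m = trans (cong₂ _+_ (cong 𝟙 (dec-false (c <? suc m) (c≰m ∘ s≤s⁻¹))) (∑-oneTo-< m c))
                      (trans (m≤n⇒m∸n≡0 (<⇒≤ m<c)) (sym (m≤n⇒m∸n≡0 m<c)))
  where m<c = ≰⇒> c≰m

∑-oneTo-≤ : ∀ m c → ∑[ y ∈ oneTo m ] 𝟙 (y ≤ᵇ c) ≡ m ⊓ c
∑-oneTo-≤ zero    c = refl
∑-oneTo-≤ (suc m) c with suc m ≤? c
... | yes m<c = trans (cong₂ _+_ (cong 𝟙 (dec-true (suc m ≤? c) m<c)) (∑-oneTo-≤ m c))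
                      (trans (cong suc (m≤n⇒m⊓n≡m (<⇒≤ m<c))) (sym (m≤n⇒m⊓n≡m m<c)))
... | no  m≮c = trans (cong₂ _+_ (cong 𝟙 (dec-false (suc m ≤? c) m≮c)) (∑-oneTo-≤ m c))
                      (trans (m≥n⇒m⊓n≡n (≤-pred c<1+m)) (sym (m≥n⇒m⊓n≡n (<⇒≤ c<1+m))))
  where c<1+m = ≰⇒> m≮c

∑-oneTo-∸ : ∀ m → ∑[ x ∈ oneTo m ] (m ∸ x) ≡ m C 2
∑-oneTo-∸ zero    = refl
∑-oneTo-∸ (suc m) = begin
  (m ∸ m) + ∑[ x ∈ oneTo m ] (suc m ∸ x)
    ≡⟨ cong₂ _+_ (n∸n≡0 m) (∑-cong (oneTo m) (+-∸-assoc 1 ∘ proj₂ ∘ ∈-oneTo⁻)) ⟩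
  ∑[ x ∈ oneTo m ] (1 + (m ∸ x))
    ≡⟨ ∑-+ (oneTo m) (λ _ → 1) (m ∸_) ⟩
  ∑[ _ ∈ oneTo m ] 1 + ∑[ x ∈ oneTo m ] (m ∸ x)
    ≡⟨ cong₂ _+_ (trans (∑-oneTo-const m 1) (*-identityʳ m)) (∑-oneTo-∸ m) ⟩
  m + m C 2
    ≡⟨ cong (_+ m C 2) (nC1≡n m) ⟨
  m C 1 + m C 2
    ≡⟨ nCk+nC[k+1]≡[n+1]C[k+1] m 1 ⟩
  suc m C 2 ∎
  where open ≡-Reasoning

2*nC2≡n*[n∸1] : ∀ n → 2 * (n C 2) ≡ n * (n ∸ 1)
2*nC2≡n*[n∸1] zero          = refl
2*nC2≡n*[n∸1] (suc zero)    = refl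
2*nC2≡n*[n∸1] (suc (suc n)) = begin
  2 * (suc (suc n) C 2)
    ≡⟨ cong (2 *_) (nCk+nC[k+1]≡[n+1]C[k+1] (suc n) 1) ⟨
  2 * (suc n C 1 + suc n C 2)
    ≡⟨ *-distribˡ-+ 2 (suc n C 1) _ ⟩
  2 * (suc n C 1) + 2 * (suc n C 2)
    ≡⟨ cong₂ (λ a b → 2 * a + b) (nC1≡n (suc n)) (2*nC2≡n*[n∸1] (suc n)) ⟩
  2 * suc n + suc n * n
    ≡⟨ regroup n ⟩
  suc (suc n) * suc n ∎
  where
  open ≡-Reasoning
  regroup : ∀ n → 2 * suc n + suc n * n ≡ suc (suc n) * suc n
  regroup = solve-∀

module _ (m t : ℕ) where
  private
    M : ℕ
    M = suc (m + t)
    P : List ℕ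
    P = oneTo m
    m<M : m < M
    m<M = s≤s (m≤m+n m t)
    bounds : ∀ {a} → a ∈ P → 0 < a × a < M
    bounds a∈P = let (0<a , a≤m) = ∈-oneTo⁻ a∈P in 0<a , ≤-<-trans a≤m m<M
    3M≡M+M+M : 3 * M ≡ M + M + M
    3M≡M+M+M = 3k≡k+k+k M
      where 3k≡k+k+k : ∀ k → 3 * k ≡ k + k + k
            3k≡k+k+k = solve-∀
    <3M : ∀ {a b c} → a ≤ M → b < M → c ≤ M → a + b + c < 3 * M
    <3M {a} {b} {c} a≤M b<M c≤M =
      subst (a + b + c <_) (sym 3M≡M+M+M) (+-mono-<-≤ (+-mono-≤-< a≤M b<M) c≤M)
    M≤y+m⇔t<y : ∀ {y} → (M ≤ y + m) ⇔ (t < y)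
    M≤y+m⇔t<y {y} = mk⇔
      (λ M≤y+m → +-cancelʳ-≤ m (suc t) y (subst (_≤ y + m) (cong suc (+-comm m t)) M≤y+m))
      (λ t<y → ≤-trans (≤-reflexive (sym (+-suc m t))) (≤-trans (+-monoʳ-≤ m t<y) (≤-reflexive (+-comm m y))))

  coreModulus : ℕ
  coreModulus = 3 * M

  coreSet : List ℕ
  coreSet = M ∷ P

  length-coreSet : length coreSet ≡ suc m
  length-coreSet = cong suc (length-applyDownFrom suc m)

  private
    differsBy-M-M : differsBy coreSet M M ≡ false
    differsBy-M-M = differsBy-irrefl M (z<s ∷ All.tabulate (proj₁ ∘ bounds))

    inConnSet-M+M : inConnSet coreModulus coreSet (M + M) ≡ true
    inConnSet-M+M = dec-true (T? _) (Equivalence.from (inConnSet-spec {coreModulus} {coreSet} {M + M})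
                                                      (M , here refl , inj₂ (sym 3M≡M+M+M)))

    differsBy-M : ∀ {y} → y ∈ P → differsBy coreSet M y ≡ (t <ᵇ y)
    differsBy-M {y} y∈P = ≡does differsBy-spec to from (t <? y)
      where
      0<y = proj₁ (bounds y∈P)
      y<M = proj₂ (bounds y∈P)
      to : (∃[ s ] s ∈ coreSet × (M + s ≡ y ⊎ y + s ≡ M)) → t < y
      to (_ , here refl , inj₁ eq) = contradiction (sym eq) (<⇒≢ (<-≤-trans y<M (m≤m+n M M)))
      to (_ , here refl , inj₂ eq) = contradiction (sym eq) (<⇒≢ (m<n+m M 0<y))
      to (s , there s∈P , inj₁ eq) = contradiction (sym eq) (<⇒≢ (<-≤-trans y<M (m≤m+n M s)))
      to (s , there s∈P , inj₂ eq) =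
        Equivalence.to M≤y+m⇔t<y (≤-trans (≤-reflexive (sym eq)) (+-monoʳ-≤ y (proj₂ (∈-oneTo⁻ s∈P))))
      from : t < y → ∃[ s ] s ∈ coreSet × (M + s ≡ y ⊎ y + s ≡ M)
      from t<y = M ∸ y
               , there (∈-oneTo⁺ (m<n⇒0<n∸m y<M) (m≤n+o⇒m∸n≤o M y (Equivalence.from M≤y+m⇔t<y t<y)))
               , inj₂ (m+[n∸m]≡n (<⇒≤ y<M))

    inConnSet-M+ : ∀ {y} → y ∈ P → inConnSet coreModulus coreSet (M + y) ≡ false
    inConnSet-M+ {y} y∈P =
      dec-false (T? _) (impossible ∘ Equivalence.to (inConnSet-spec {coreModulus} {coreSet} {M + y}))
      where
      0<y = proj₁ (bounds y∈P)
      y<M = proj₂ (bounds y∈P)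
      impossible : ¬ (∃[ s ] s ∈ coreSet × (s ≡ M + y ⊎ M + y + s ≡ 3 * M))
      impossible (_ , here refl , inj₁ eq) = <-irrefl eq (m<m+n M 0<y)
      impossible (_ , here refl , inj₂ eq) = <-irrefl eq (<3M ≤-refl y<M ≤-refl)
      impossible (s , there s∈P , inj₁ eq) = <-irrefl eq (<-≤-trans (proj₂ (bounds s∈P)) (m≤m+n M y))
      impossible (s , there s∈P , inj₂ eq) = <-irrefl eq (<3M ≤-refl y<M (<⇒≤ (proj₂ (bounds s∈P))))

    differsBy-oneTo : ∀ {x y} → x ∈ P → y ∈ P → differsBy coreSet x y ≡ not (x ≡ᵇ y)
    differsBy-oneTo {x} {y} x∈P y∈P = ≡does (differsBy-spec {coreSet} {x} {y}) to from (¬? (x ≟ y))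
      where
      y<M = proj₂ (bounds y∈P)
      x<M = proj₂ (bounds x∈P)
      to : (∃[ s ] s ∈ coreSet × (x + s ≡ y ⊎ y + s ≡ x)) → x ≢ y
      to (_ , here refl , inj₁ eq) _   = <-irrefl (sym eq) (<-≤-trans y<M (m≤n+m M x))
      to (_ , here refl , inj₂ eq) _   = <-irrefl (sym eq) (<-≤-trans x<M (m≤n+m M y))
      to (s , there s∈P , inj₁ eq) x≡y = <-irrefl (sym (trans eq (sym x≡y))) (m<m+n x (proj₁ (bounds s∈P)))
      to (s , there s∈P , inj₂ eq) x≡y = <-irrefl (sym (trans eq x≡y)) (m<m+n y (proj₁ (bounds s∈P)))
      difference∈P : ∀ {a b} → a < b → b ∈ P → b ∸ a ∈ P
      difference∈P {a} {b} a<b b∈P =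
        ∈-oneTo⁺ (m<n⇒0<n∸m a<b) (≤-trans (m∸n≤m b a) (proj₂ (∈-oneTo⁻ b∈P)))
      from : x ≢ y → ∃[ s ] s ∈ coreSet × (x + s ≡ y ⊎ y + s ≡ x)
      from x≢y with <-cmp x y
      ... | tri< x<y _ _ = y ∸ x , there (difference∈P x<y y∈P) , inj₁ (m+[n∸m]≡n (<⇒≤ x<y))
      ... | tri≈ _ x≡y _ = contradiction x≡y x≢y
      ... | tri> _ _ y<x = x ∸ y , there (difference∈P y<x x∈P) , inj₂ (m+[n∸m]≡n (<⇒≤ y<x))

    inConnSet-oneTo : ∀ {x y} → x ∈ P → y ∈ P →
                      inConnSet coreModulus coreSet (x + y) ≡ (M ≡ᵇ x + y) ∨ (x + y ≤ᵇ m)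
    inConnSet-oneTo {x} {y} x∈P y∈P =
      ≡does (inConnSet-spec {coreModulus} {coreSet} {x + y}) to from ((M ≟ x + y) ⊎-dec (x + y ≤? m))
      where
      x<M = proj₂ (bounds x∈P)
      y<M = proj₂ (bounds y∈P)
      to : (∃[ s ] s ∈ coreSet × (s ≡ x + y ⊎ x + y + s ≡ 3 * M)) → M ≡ x + y ⊎ x + y ≤ m
      to (_ , here refl , inj₁ eq) = inj₁ eq
      to (_ , here refl , inj₂ eq) = contradiction eq (<⇒≢ (<3M (<⇒≤ x<M) y<M ≤-refl))
      to (s , there s∈P , inj₁ eq) = inj₂ (subst (_≤ m) eq (proj₂ (∈-oneTo⁻ s∈P)))
      to (s , there s∈P , inj₂ eq) = contradiction eq (<⇒≢ (<3M (<⇒≤ x<M) y<M (<⇒≤ (proj₂ (bounds s∈P)))))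
      from : M ≡ x + y ⊎ x + y ≤ m → ∃[ s ] s ∈ coreSet × (s ≡ x + y ⊎ x + y + s ≡ 3 * M)
      from (inj₁ eq)    = M , here refl , inj₁ eq
      from (inj₂ x+y≤m) = x + y , there (∈-oneTo⁺ (<-≤-trans (proj₁ (bounds x∈P)) (m≤m+n x y)) x+y≤m) , inj₁ refl

    w : ℕ → ℕ → ℕ
    w = pairWeight coreModulus coreSet

    pairWeight-M-M : w M M ≡ 1
    pairWeight-M-M = cong₂ _+_ (cong 𝟙 differsBy-M-M) (cong 𝟙 inConnSet-M+M)

    pairWeight-M : ∀ {y} → y ∈ P → w M y ≡ 𝟙 (t <ᵇ y)
    pairWeight-M y∈P = trans (cong₂ _+_ (cong 𝟙 (differsBy-M y∈P)) (cong 𝟙 (inConnSet-M+ y∈P))) (+-identityʳ _)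

    pairWeight-oneTo : ∀ {x y} → x ∈ P → y ∈ P → w x y ≡ 𝟙 (not (x ≡ᵇ y)) + (𝟙 (M ≡ᵇ x + y) + 𝟙 (x + y ≤ᵇ m))
    pairWeight-oneTo {x} {y} x∈P y∈P =
      cong₂ _+_ (cong 𝟙 (differsBy-oneTo x∈P y∈P)) (trans (cong 𝟙 (inConnSet-oneTo x∈P y∈P)) (𝟙-∨-disjoint disjoint))
      where
      disjoint : T (M ≡ᵇ x + y) → T (x + y ≤ᵇ m) → ⊥
      disjoint M≡x+y x+y≤m = <-irrefl (sym (≡ᵇ⇒≡ M (x + y) M≡x+y)) (≤-<-trans (≤ᵇ⇒≤ (x + y) m x+y≤m) m<M)

    ∑-≢ : ∀ {x} → x ∈ P → ∑[ y ∈ P ] 𝟙 (not (x ≡ᵇ y)) ≡ m ∸ 1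
    ∑-≢ {x} x∈P = begin
      ∑[ y ∈ P ] 𝟙 (not (x ≡ᵇ y))
        ≡⟨ m+n∸n≡m _ 1 ⟨
      ∑[ y ∈ P ] 𝟙 (not (x ≡ᵇ y)) + 1 ∸ 1
        ≡⟨ cong (λ k → ∑[ y ∈ P ] 𝟙 (not (x ≡ᵇ y)) + k ∸ 1) (∑-count-∈ (oneTo-unique m) x∈P) ⟨
      ∑[ y ∈ P ] 𝟙 (not (x ≡ᵇ y)) + ∑[ y ∈ P ] 𝟙 (x ≡ᵇ y) ∸ 1
        ≡⟨ cong (_∸ 1) (∑-+ P _ _) ⟨
      ∑[ y ∈ P ] (𝟙 (not (x ≡ᵇ y)) + 𝟙 (x ≡ᵇ y)) ∸ 1
        ≡⟨ cong (_∸ 1) (∑-cong P (λ {y} _ → 𝟙-not+𝟙 (x ≡ᵇ y))) ⟩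
      ∑[ _ ∈ P ] 1 ∸ 1
        ≡⟨ cong (_∸ 1) (trans (∑-oneTo-const m 1) (*-identityʳ m)) ⟩
      m ∸ 1 ∎
      where
      open ≡-Reasoning
      𝟙-not+𝟙 : ∀ b → 𝟙 (not b) + 𝟙 b ≡ 1
      𝟙-not+𝟙 true  = refl
      𝟙-not+𝟙 false = refl

    ∑-≡M : ∀ {x} → x ∈ P → ∑[ y ∈ P ] 𝟙 (M ≡ᵇ x + y) ≡ 𝟙 (t <ᵇ x)
    ∑-≡M {x} x∈P = trans (∑-cong P (λ {y} _ → cong 𝟙 (does-⇔ M≡x+y⇔M∸x≡y (M ≟ x + y) (M ∸ x ≟ y)))) count
      where
      x<M = proj₂ (bounds x∈P)
      M≡x+y⇔M∸x≡y : ∀ {y} → (M ≡ x + y) ⇔ (M ∸ x ≡ y)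
      M≡x+y⇔M∸x≡y {y} = mk⇔ (λ eq → trans (cong (_∸ x) eq) (m+n∸m≡n x y))
                            (λ eq → trans (sym (m+[n∸m]≡n (<⇒≤ x<M))) (cong (x +_) eq))
      M∸x∈P⇔t<x : M ∸ x ∈ P ⇔ t < x
      M∸x∈P⇔t<x = mk⇔ (λ M∸x∈P → Equivalence.to M≤y+m⇔t<y (M≤x+m (proj₂ (∈-oneTo⁻ M∸x∈P))))
                      (λ t<x → ∈-oneTo⁺ (m<n⇒0<n∸m x<M) (m≤n+o⇒m∸n≤o M x (Equivalence.from M≤y+m⇔t<y t<x)))
        where
        M≤x+m : M ∸ x ≤ m → M ≤ x + m
        M≤x+m M∸x≤m = subst (_≤ x + m) (m+[n∸m]≡n (<⇒≤ x<M)) (+-monoʳ-≤ x M∸x≤m)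
      count : ∑[ y ∈ P ] 𝟙 (M ∸ x ≡ᵇ y) ≡ 𝟙 (t <ᵇ x)
      count with t <? x
      ... | yes t<x = trans (∑-count-∈ (oneTo-unique m) (Equivalence.from M∸x∈P⇔t<x t<x))
                            (cong 𝟙 (sym (dec-true (t <? x) t<x)))
      ... | no  t≮x = trans (∑-count-∉ (t≮x ∘ Equivalence.to M∸x∈P⇔t<x))
                            (cong 𝟙 (sym (dec-false (t <? x) t≮x)))

    ∑-≤m : ∀ {x} → x ∈ P → ∑[ y ∈ P ] 𝟙 (x + y ≤ᵇ m) ≡ m ∸ x
    ∑-≤m {x} x∈P = begin
      ∑[ y ∈ P ] 𝟙 (x + y ≤ᵇ m)  ≡⟨ ∑-cong P (λ {y} _ → cong 𝟙 (does-⇔ x+y≤m⇔y≤m∸x (x + y ≤? m) (y ≤? m ∸ x))) ⟩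
      ∑[ y ∈ P ] 𝟙 (y ≤ᵇ m ∸ x)  ≡⟨ ∑-oneTo-≤ m (m ∸ x) ⟩
      m ⊓ (m ∸ x)                ≡⟨ m≥n⇒m⊓n≡n (m∸n≤m m x) ⟩
      m ∸ x                      ∎
      where
      open ≡-Reasoning
      x≤m = proj₂ (∈-oneTo⁻ x∈P)
      x+y≤m⇔y≤m∸x : ∀ {y} → (x + y ≤ m) ⇔ (y ≤ m ∸ x)
      x+y≤m⇔y≤m∸x {y} = mk⇔ (λ le → m+n≤o⇒m≤o∸n y (subst (_≤ m) (+-comm x y) le))
                            (λ le → subst (_≤ m) (+-comm y x) (m≤o∸n⇒m+n≤o y x≤m le))

    row : ∀ {x} → x ∈ P → w x M + ∑[ y ∈ P ] w x y ≡ 𝟙 (t <ᵇ x) + ((m ∸ 1) + (𝟙 (t <ᵇ x) + (m ∸ x)))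
    row {x} x∈P = cong₂ _+_ (trans (pairWeight-sym coreModulus coreSet x M) (pairWeight-M x∈P)) $ begin
      ∑[ y ∈ P ] w x y
        ≡⟨ ∑-cong P (pairWeight-oneTo x∈P) ⟩
      ∑[ y ∈ P ] (𝟙 (not (x ≡ᵇ y)) + (𝟙 (M ≡ᵇ x + y) + 𝟙 (x + y ≤ᵇ m)))
        ≡⟨ trans (∑-+ P _ _) (cong (∑[ y ∈ P ] 𝟙 (not (x ≡ᵇ y)) +_) (∑-+ P _ _)) ⟩
      ∑[ y ∈ P ] 𝟙 (not (x ≡ᵇ y)) + (∑[ y ∈ P ] 𝟙 (M ≡ᵇ x + y) + ∑[ y ∈ P ] 𝟙 (x + y ≤ᵇ m))
        ≡⟨ cong₂ _+_ (∑-≢ x∈P) (cong₂ _+_ (∑-≡M x∈P) (∑-≤m x∈P)) ⟩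
      (m ∸ 1) + (𝟙 (t <ᵇ x) + (m ∸ x)) ∎
      where open ≡-Reasoning

  coreSet-admissible : Admissible coreModulus coreSet
  coreSet-admissible = record
    { 2≤n     = ≤-trans (s≤s (s≤s z≤n)) (*-monoʳ-≤ 3 (s≤s z≤n))
    ; unique  = All.tabulate (λ a∈P → ≢-sym (<⇒≢ (proj₂ (bounds a∈P)))) ∷ oneTo-unique m
    ; bounded = (z<s , 2M<3M)
                ∷ All.tabulate (λ a∈P → proj₁ (bounds a∈P) , <-trans (*-monoʳ-< 2 (proj₂ (bounds a∈P))) 2M<3M)
    }
    where
    2M<3M : 2 * M < 3 * M
    2M<3M = *-monoˡ-< M {2} {3} (s≤s (s≤s (s≤s z≤n)))

  coreSet-edges : neighbourhoodEdges coreModulus coreSet ≡ 1 + 3 * (m C 2 + (m ∸ t))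
  coreSet-edges = begin
    w M M + ∑[ y ∈ P ] w M y + ∑[ x ∈ P ] (w x M + ∑[ y ∈ P ] w x y)
      ≡⟨ cong₂ _+_ (cong₂ _+_ pairWeight-M-M (∑-cong P pairWeight-M)) (∑-cong P row) ⟩
    1 + ∑[ y ∈ P ] 𝟙 (t <ᵇ y) + ∑[ x ∈ P ] (𝟙 (t <ᵇ x) + ((m ∸ 1) + (𝟙 (t <ᵇ x) + (m ∸ x))))
      ≡⟨ cong (1 + j +_) split-rows ⟩
    1 + j + (j + (∑[ _ ∈ P ] (m ∸ 1) + (j + ∑[ x ∈ P ] (m ∸ x))))
      ≡⟨ cong₂ (λ a b → 1 + j + (j + (a + (j + b)))) (∑-oneTo-const m (m ∸ 1)) (∑-oneTo-∸ m) ⟩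
    1 + j + (j + (m * (m ∸ 1) + (j + m C 2)))
      ≡⟨ cong (λ a → 1 + j + (j + (a + (j + m C 2)))) (2*nC2≡n*[n∸1] m) ⟨
    1 + j + (j + (2 * (m C 2) + (j + m C 2)))
      ≡⟨ collect j (m C 2) ⟩
    1 + 3 * (m C 2 + j)
      ≡⟨ cong (λ k → 1 + 3 * (m C 2 + k)) (∑-oneTo-< m t) ⟩
    1 + 3 * (m C 2 + (m ∸ t)) ∎
    where
    open ≡-Reasoning
    j = ∑[ y ∈ P ] 𝟙 (t <ᵇ y)
    split-rows : ∑[ x ∈ P ] (𝟙 (t <ᵇ x) + ((m ∸ 1) + (𝟙 (t <ᵇ x) + (m ∸ x))))
               ≡ j + (∑[ _ ∈ P ] (m ∸ 1) + (j + ∑[ x ∈ P ] (m ∸ x)))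
    split-rows = trans (∑-+ P _ _) (cong (j +_) (trans (∑-+ P _ _) (cong (∑[ _ ∈ P ] (m ∸ 1) +_) (∑-+ P _ _))))
    collect : ∀ j Δ → 1 + j + (j + (2 * Δ + (j + Δ))) ≡ 1 + 3 * (Δ + j)
    collect = solve-∀

-- The parameters

even-split : ∀ k r → 2 * k ≤ r → r % 2 ≡ 0 → ∃[ p ] 2 * (p + k) ≡ r
even-split k r 2k≤r r%2≡0 = r / 2 ∸ k , trans (cong (2 *_) (m∸n+n≡m k≤r/2)) (sym r≡2*[r/2])
  where
  r≡2*[r/2] : r ≡ 2 * (r / 2)
  r≡2*[r/2] = trans (m≡m%n+[m/n]*n r 2) (trans (cong (_+ (r / 2) * 2) r%2≡0) (*-comm (r / 2) 2))
  k≤r/2 : k ≤ r / 2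
  k≤r/2 = *-cancelˡ-≤ 2 (subst (2 * k ≤_) r≡2*[r/2] 2k≤r)

residue-one-split : ∀ m c → c % 3 ≡ 1 → 3 * ((m ∸ 1) * m) ≤ 2 * c → 2 * c ≤ 3 * (suc m * m) →
                    ∃[ j ] j ≤ m × 1 + 3 * (m C 2 + j) ≡ c
residue-one-split m c c%3≡1 lower upper = u ∸ Δ , m≤n+o⇒m∸n≤o u Δ u≤Δ+m , c≡
  where
  Δ = m C 2
  u = c / 3
  c≡1+u*3 : c ≡ 1 + u * 3
  c≡1+u*3 = trans (m≡m%n+[m/n]*n c 3) (cong (_+ u * 3) c%3≡1)
  2c≡ : 2 * c ≡ 2 + 6 * u
  2c≡ = trans (cong (2 *_) c≡1+u*3) (regroup u)
    where regroup : ∀ u → 2 * (1 + u * 3) ≡ 2 + 6 * u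
          regroup = solve-∀
  lower′ : 6 * Δ ≤ 2 + 6 * u
  lower′ = subst₂ _≤_ 3[[m∸1]m]≡6Δ 2c≡ lower
    where
    3[[m∸1]m]≡6Δ : 3 * ((m ∸ 1) * m) ≡ 6 * Δ
    3[[m∸1]m]≡6Δ = trans (cong (3 *_) (trans (*-comm (m ∸ 1) m) (sym (2*nC2≡n*[n∸1] m)))) (sym (*-assoc 3 2 Δ))
  upper′ : 2 + 6 * u ≤ 6 * (Δ + m)
  upper′ = subst₂ _≤_ 2c≡ 3[1+m]m≡6[Δ+m] upper
    where
    open ≡-Reasoning
    3[1+m]m≡6[Δ+m] : 3 * (suc m * m) ≡ 6 * (Δ + m)
    3[1+m]m≡6[Δ+m] = begin
      3 * (suc m * m)           ≡⟨ cong (3 *_) (2*nC2≡n*[n∸1] (suc m)) ⟨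
      3 * (2 * (suc m C 2))     ≡⟨ cong (λ x → 3 * (2 * x)) (nCk+nC[k+1]≡[n+1]C[k+1] m 1) ⟨
      3 * (2 * (m C 1 + Δ))    ≡⟨ cong (λ x → 3 * (2 * (x + Δ))) (nC1≡n m) ⟩
      3 * (2 * (m + Δ))        ≡⟨ regroup m Δ ⟩
      6 * (Δ + m)              ∎
      where regroup : ∀ m Δ → 3 * (2 * (m + Δ)) ≡ 6 * (Δ + m)
            regroup = solve-∀
  Δ≤u : Δ ≤ u
  Δ≤u = ≮⇒≥ λ u<Δ →
    m+1+n≰m (2 + 6 * u) {3} (≤-trans (≤-reflexive (regroup u)) (≤-trans (*-monoʳ-≤ 6 u<Δ) lower′))
    where regroup : ∀ u → 2 + 6 * u + 4 ≡ 6 * suc u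
          regroup = solve-∀
  u≤Δ+m : u ≤ Δ + m
  u≤Δ+m = *-cancelˡ-≤ 6 (≤-trans (m≤n+m (6 * u) 2) upper′)
  c≡ : 1 + 3 * (Δ + (u ∸ Δ)) ≡ c
  c≡ = trans (cong (λ i → 1 + 3 * i) (m+[n∸m]≡n Δ≤u)) (trans (cong (1 +_) (*-comm 3 u)) (sym c≡1+u*3))

proposition3p7 : (k c r : ℕ) → 1 ≤ k → 2 * k ≤ r → r % 2 ≡ 0 → c % 3 ≡ 1
                 → 3 * ((k ∸ 2) * (k ∸ 1)) ≤ 2 * c → 2 * c ≤ 3 * (k * (k ∸ 1))
                 → ExistsRCCirculant r c
proposition3p7 (suc m) c r _ 2k≤r r%2≡0 c%3≡1 lower upper =
  let (j , j≤m , c≡) = residue-one-split m c c%3≡1 lower upper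
      (p , r≡) = even-split (suc m) r 2k≤r r%2≡0
      (n′ , S′ , adm′ , length-S′ , edges-S′) = iterate-blowUp p (coreSet-admissible m (m ∸ j))
  in subst₂ ExistsRCCirculant
       (trans (cong (2 *_) (trans length-S′ (cong (p +_) (length-coreSet m (m ∸ j))))) r≡)
       (trans edges-S′ (trans (coreSet-edges m (m ∸ j))
                              (trans (cong (λ i → 1 + 3 * (m C 2 + i)) (m∸[m∸n]≡n j≤m)) c≡)))
       (admissible⇒circulant adm′)
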